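{- Let $(\Sigma,\mathbb I)$ be a monoidal theory and let $t,s:\bigoplus_{i=1}^nU_i\to\bigoplus_{j=1}^mV_j$ be tapes of $\mathsf T_\Sigma$. Then $t\le_{\tilde{\mathbb I}}s$ if and only if for all $i,j$, $t_{ji}\le^{EM}_{\mathbb I}s_{ji}$, where $t_{ji}=\mu_i;t;\pi_j$ and $s_{ji}=\mu_i;s;\pi_j$.
   Context: Monoidal signature $(\mathcal S,\Sigma)$; $\mathsf C_\Sigma$ the free strict symmetric monoidal category (string diagrams); a monoidal theory $(\Sigma,\mathbb I)$ has $\mathbb I$ a set of pairs of arrows of $\mathsf C_\Sigma$ of equal type, and $\le_{\mathbb I}$ is the smallest reflexive transitive relation on arrows of $\mathsf C_\Sigma$ containing $\mathbb I$ closed under $;$ and $\otimes$. A finite biproduct (fb) category: symmetric monoidal $(\mathsf C,\oplus,0)$ with natural commutative monoids $\nabla_X,\mathsf i_X$ and cocommutative comonoids $\Delta_X,!_X$ coherent with $\oplus$. $\mathsf T_\Sigma$: free strict fb category on the underlying category of $\mathsf C_\Sigma$ (objects polynomials $U_1\oplus\cdots\oplus U_n$; arrows terms in $\mathrm{id}$, $\lceil c\rceil$ ($c$ in $\mathsf C_\Sigma$), $\sigma^\oplus$, $\Delta,!,\nabla,\mathsf i$, $;$, $\oplus$ modulo fb laws, naturality w.r.t. $\lceil c\rceil$, $\lceil\mathrm{id}\rceil=\mathrm{id}$, $\lceil c;d\rceil=\lceil c\rceil;\lceil d\rceil$), with tensor $\otimes$ ($(\bigoplus_iU_i)\otimes(\bigoplus_jV_j)=\bigoplus_i\bigoplus_jU_iV_j$,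 and $t_1\otimes t_2=L_{P_1}(t_2);R_{Q_2}(t_1)$ via whiskerings with $L_U(\lceil c\rceil)=\lceil\mathrm{id}_U\otimes c\rceil$, $R_U(\lceil c\rceil)=\lceil c\otimes\mathrm{id}_U\rceil$ and inductive extension to polynomials using left distributors). $\le_{\tilde{\mathbb I}}$ is the smallest reflexive transitive relation on tapes closed under $;$, $\oplus$, $\otimes$ containing $(\lceil c\rceil,\lceil d\rceil)$ for $(c,d)\in\mathbb I$ and, for each monomial $U$, $\mathrm{id}_0\le\mathsf i_U;!_U$, $!_U;\mathsf i_U\le\mathrm{id}_U$, $\mathrm{id}_U\oplus\mathrm{id}_U\le\nabla_U;\Delta_U$, $\Delta_U;\nabla_U\le\mathrm{id}_U$. Injections and projections: $\mu_i=\bigoplus_{k<i}\mathsf i_{U_k}\oplus\mathrm{id}_{U_i}\oplus\bigoplus_{k>i}\mathsf i_{U_k}:U_i\to\bigoplus_kU_k$ (via $U_i\cong 0\oplus\cdots\oplus U_i\oplus\cdots\oplus 0$) and dually $\pi_j=\bigoplus_{k<j}!_{V_k}\oplus\mathrm{id}_{V_j}\oplus\bigoplus_{k>j}!_{V_k}$. For tapes $a,b:U\to V$ between monomials define $a+b=\Delta_U;(a\oplus b);\nabla_V$ and $\mathfrak o=!_U;\mathsf i_V$; every tape between monomials is a finite sum $\sum_h\lceil c_h\rceil$ (the empty sum being $\mathfrak o$), uniquely up to reordering. $\sum_{h=1}^n\lceil c_h\rceil\le^{EM}_{\mathbb I}\sum_{k=1}^m\lceil d_k\rceil$ iff for every $h$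 there is $k$ with $c_h\le_{\mathbb I}d_k$. -}

module Defs where

open import Data.List using (List; []; _∷_; _++_; map; length; lookup)
open import Data.List.Properties using (++-assoc; map-++)
open import Data.List.Relation.Unary.All using (All)
open import Data.List.Relation.Unary.Any using (Any)
open import Data.Fin using (Fin; zero; suc)
open import Data.Product using (∃-syntax; Σ-syntax; _×_; _,_)
open import Relation.Binary.PropositionalEquality using (_≡_; refl; sym; trans; cong)

record Signature : Set₁ where
  field
    Sort : Set
    Gen  : Set
    ar   : Gen → List Sort
    coar : Gen → List Sort
open Signature public

-- C_Σ : free strict symmetric monoidal category (terms modulo SMC laws)

module _ (𝒮 : Signature) where

  Mono : Set
  Mono = List (Sort 𝒮)

  Poly : Set
  Poly = List Mono

  infixr 5 _⨾C_
  infixr 6 _⊗C_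

  data Circ : Mono → Mono → Set where
    idC  : (u : Mono) → Circ u u
    gen  : (g : Gen 𝒮) → Circ (ar 𝒮 g) (coar 𝒮 g)
    σC   : (u v : Mono) → Circ (u ++ v) (v ++ u)
    _⨾C_ : ∀ {u v w} → Circ u v → Circ v w → Circ u w
    _⊗C_ : ∀ {u v u' v'} → Circ u v → Circ u' v' → Circ (u ++ u') (v ++ v')

module _ {𝒮 : Signature} where

  -- equality of arrows of C_Σ (heterogeneous in the (propositionally equal) types,
  -- so that strict associativity/unit laws can be stated without casts)
  infix 4 _≈C_
  data _≈C_ : ∀ {u v u' v'} → Circ 𝒮 u v → Circ 𝒮 u' v' → Set where
    ≈refl  : ∀ {u v} {f : Circ 𝒮 u v} → f ≈C f
    ≈sym   : ∀ {u v u' v'} {f : Circ 𝒮 u v} {g : Circ 𝒮 u' v'} → f ≈C g → g ≈C f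
    ≈trans : ∀ {u v u' v' u'' v''} {f : Circ 𝒮 u v} {g : Circ 𝒮 u' v'} {h : Circ 𝒮 u'' v''} →
             f ≈C g → g ≈C h → f ≈C h
    ⨾-cong : ∀ {u v w u' v' w'} {f : Circ 𝒮 u v} {g : Circ 𝒮 v w} {f' : Circ 𝒮 u' v'} {g' : Circ 𝒮 v' w'} →
             f ≈C f' → g ≈C g' → (f ⨾C g) ≈C (f' ⨾C g')
    ⊗-cong : ∀ {u v w x u' v' w' x'} {f : Circ 𝒮 u v} {g : Circ 𝒮 w x} {f' : Circ 𝒮 u' v'} {g' : Circ 𝒮 w' x'} →
             f ≈C f' → g ≈C g' → (f ⊗C g) ≈C (f' ⊗C g')
    idˡ    : ∀ {u v} (f : Circ 𝒮 u v) → (idC u ⨾C f) ≈C f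
    idʳ    : ∀ {u v} (f : Circ 𝒮 u v) → (f ⨾C idC v) ≈C f
    ⨾-assoc : ∀ {u v w x} (f : Circ 𝒮 u v) (g : Circ 𝒮 v w) (h : Circ 𝒮 w x) →
              ((f ⨾C g) ⨾C h) ≈C (f ⨾C (g ⨾C h))
    ⊗-assoc : ∀ {u v w x y z} (f : Circ 𝒮 u v) (g : Circ 𝒮 w x) (h : Circ 𝒮 y z) →
              ((f ⊗C g) ⊗C h) ≈C (f ⊗C (g ⊗C h))
    ⊗-unitˡ : ∀ {u v} (f : Circ 𝒮 u v) → (idC [] ⊗C f) ≈C f
    ⊗-unitʳ : ∀ {u v} (f : Circ 𝒮 u v) → (f ⊗C idC []) ≈C f
    id⊗id   : (u v : Mono 𝒮) → (idC u ⊗C idC v) ≈C idC (u ++ v)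
    interchange : ∀ {u v w u' v' w'} (f : Circ 𝒮 u v) (g : Circ 𝒮 v w) (f' : Circ 𝒮 u' v') (g' : Circ 𝒮 v' w') →
                  ((f ⨾C g) ⊗C (f' ⨾C g')) ≈C ((f ⊗C f') ⨾C (g ⊗C g'))
    σ-nat  : ∀ {u v u' v'} (f : Circ 𝒮 u v) (g : Circ 𝒮 u' v') →
             ((f ⊗C g) ⨾C σC v v') ≈C (σC u u' ⨾C (g ⊗C f))
    σ-inv  : (u v : Mono 𝒮) → (σC u v ⨾C σC v u) ≈C idC (u ++ v)
    σ-unit : (u : Mono 𝒮) → σC u [] ≈C idC u
    σ-hex  : (u : Mono 𝒮) (x : Sort 𝒮) (w : Mono 𝒮) →
             σC u (x ∷ w) ≈C ((σC u (x ∷ []) ⊗C idC w) ⨾C (idC (x ∷ []) ⊗C σC u w))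

module _ (𝒮 : Signature) where

  Theory : Set₁
  Theory = ∀ {u v} → Circ 𝒮 u v → Circ 𝒮 u v → Set

module _ {𝒮 : Signature} where

  data LeC (𝕀 : Theory 𝒮) : ∀ {u v} → Circ 𝒮 u v → Circ 𝒮 u v → Set where
    ax     : ∀ {u v} {c d : Circ 𝒮 u v} → 𝕀 c d → LeC 𝕀 c d
    ≈⇒≤    : ∀ {u v} {c d : Circ 𝒮 u v} → c ≈C d → LeC 𝕀 c d
    ≤trans : ∀ {u v} {c d e : Circ 𝒮 u v} → LeC 𝕀 c d → LeC 𝕀 d e → LeC 𝕀 c e
    ⨾-mono : ∀ {u v w} {f f' : Circ 𝒮 u v} {g g' : Circ 𝒮 v w} →
             LeC 𝕀 f f' → LeC 𝕀 g g' → LeC 𝕀 (f ⨾C g) (f' ⨾C g')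
    ⊗-mono : ∀ {u v u' v'} {f f' : Circ 𝒮 u v} {g g' : Circ 𝒮 u' v'} →
             LeC 𝕀 f f' → LeC 𝕀 g g' → LeC 𝕀 (f ⊗C g) (f' ⊗C g')

module _ (𝒮 : Signature) where

  -- T_Σ : free strict fb category on the underlying category of C_Σ
  -- objects: polynomials (lists of monomials), ⊕ = list concatenation

  infixr 5 _⨾_
  infixr 6 _⊕_

  data Tape : Poly 𝒮 → Poly 𝒮 → Set where
    ⌈_⌉  : ∀ {u v} → Circ 𝒮 u v → Tape (u ∷ []) (v ∷ [])
    idT  : (P : Poly 𝒮) → Tape P P
    σ⊕   : (P Q : Poly 𝒮) → Tape (P ++ Q) (Q ++ P)
    Δ    : (P : Poly 𝒮) → Tape P (P ++ P)
    !    : (P : Poly 𝒮) → Tape P []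
    ∇    : (P : Poly 𝒮) → Tape (P ++ P) P
    ¡    : (P : Poly 𝒮) → Tape [] P
    _⨾_  : ∀ {P Q R} → Tape P Q → Tape Q R → Tape P R
    _⊕_  : ∀ {P Q P' Q'} → Tape P Q → Tape P' Q' → Tape (P ++ P') (Q ++ Q')

module _ {𝒮 : Signature} where

  infix 4 _≈T_
  data _≈T_ : ∀ {P Q P' Q'} → Tape 𝒮 P Q → Tape 𝒮 P' Q' → Set where
    ≈refl  : ∀ {P Q} {t : Tape 𝒮 P Q} → t ≈T t
    ≈sym   : ∀ {P Q P' Q'} {t : Tape 𝒮 P Q} {s : Tape 𝒮 P' Q'} → t ≈T s → s ≈T t
    ≈trans : ∀ {P Q P' Q' P'' Q''} {t : Tape 𝒮 P Q} {s : Tape 𝒮 P' Q'} {r : Tape 𝒮 P'' Q''} →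
             t ≈T s → s ≈T r → t ≈T r
    ⨾-cong : ∀ {P Q R P' Q' R'} {t : Tape 𝒮 P Q} {s : Tape 𝒮 Q R} {t' : Tape 𝒮 P' Q'} {s' : Tape 𝒮 Q' R'} →
             t ≈T t' → s ≈T s' → (t ⨾ s) ≈T (t' ⨾ s')
    ⊕-cong : ∀ {P Q R S P' Q' R' S'} {t : Tape 𝒮 P Q} {s : Tape 𝒮 R S} {t' : Tape 𝒮 P' Q'} {s' : Tape 𝒮 R' S'} →
             t ≈T t' → s ≈T s' → (t ⊕ s) ≈T (t' ⊕ s')
    idˡ    : ∀ {P Q} (t : Tape 𝒮 P Q) → (idT P ⨾ t) ≈T t
    idʳ    : ∀ {P Q} (t : Tape 𝒮 P Q) → (t ⨾ idT Q) ≈T t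
    ⨾-assoc : ∀ {P Q R S} (t : Tape 𝒮 P Q) (s : Tape 𝒮 Q R) (r : Tape 𝒮 R S) →
              ((t ⨾ s) ⨾ r) ≈T (t ⨾ (s ⨾ r))
    ⊕-assoc : ∀ {P Q R S X Y} (t : Tape 𝒮 P Q) (s : Tape 𝒮 R S) (r : Tape 𝒮 X Y) →
              ((t ⊕ s) ⊕ r) ≈T (t ⊕ (s ⊕ r))
    ⊕-unitˡ : ∀ {P Q} (t : Tape 𝒮 P Q) → (idT [] ⊕ t) ≈T t
    ⊕-unitʳ : ∀ {P Q} (t : Tape 𝒮 P Q) → (t ⊕ idT []) ≈T t
    id⊕id   : (P Q : Poly 𝒮) → (idT P ⊕ idT Q) ≈T idT (P ++ Q)
    interchange : ∀ {P Q R P' Q' R'} (t : Tape 𝒮 P Q) (s : Tape 𝒮 Q R) (t' : Tape 𝒮 P' Q') (s' : Tape 𝒮 Q' R') →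
                  ((t ⨾ s) ⊕ (t' ⨾ s')) ≈T ((t ⊕ t') ⨾ (s ⊕ s'))
    σ-nat  : ∀ {P Q P' Q'} (t : Tape 𝒮 P Q) (s : Tape 𝒮 P' Q') →
             ((t ⊕ s) ⨾ σ⊕ Q Q') ≈T (σ⊕ P P' ⨾ (s ⊕ t))
    σ-inv  : (P Q : Poly 𝒮) → (σ⊕ P Q ⨾ σ⊕ Q P) ≈T idT (P ++ Q)
    σ-unit : (P : Poly 𝒮) → σ⊕ P [] ≈T idT P
    σ-hex  : (P : Poly 𝒮) (U : Mono 𝒮) (R : Poly 𝒮) →
             σ⊕ P (U ∷ R) ≈T ((σ⊕ P (U ∷ []) ⊕ idT R) ⨾ (idT (U ∷ []) ⊕ σ⊕ P R))
    ⌈⌉-cong : ∀ {u v u' v'} {c : Circ 𝒮 u v} {d : Circ 𝒮 u' v'} → c ≈C d → ⌈ c ⌉ ≈T ⌈ d ⌉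
    ⌈id⌉    : (u : Mono 𝒮) → ⌈ idC u ⌉ ≈T idT (u ∷ [])
    ⌈⨾⌉     : ∀ {u v w} (c : Circ 𝒮 u v) (d : Circ 𝒮 v w) → ⌈ c ⨾C d ⌉ ≈T (⌈ c ⌉ ⨾ ⌈ d ⌉)
    ∇-assoc : (P : Poly 𝒮) → ((∇ P ⊕ idT P) ⨾ ∇ P) ≈T ((idT P ⊕ ∇ P) ⨾ ∇ P)
    ∇-unit  : (P : Poly 𝒮) → ((¡ P ⊕ idT P) ⨾ ∇ P) ≈T idT P
    ∇-comm  : (P : Poly 𝒮) → (σ⊕ P P ⨾ ∇ P) ≈T ∇ P
    Δ-assoc : (P : Poly 𝒮) → (Δ P ⨾ (Δ P ⊕ idT P)) ≈T (Δ P ⨾ (idT P ⊕ Δ P))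
    Δ-unit  : (P : Poly 𝒮) → (Δ P ⨾ (! P ⊕ idT P)) ≈T idT P
    Δ-comm  : (P : Poly 𝒮) → (Δ P ⨾ σ⊕ P P) ≈T Δ P
    Δ-nat : ∀ {P Q} (t : Tape 𝒮 P Q) → (t ⨾ Δ Q) ≈T (Δ P ⨾ (t ⊕ t))
    !-nat : ∀ {P Q} (t : Tape 𝒮 P Q) → (t ⨾ ! Q) ≈T ! P
    ∇-nat : ∀ {P Q} (t : Tape 𝒮 P Q) → (∇ P ⨾ t) ≈T ((t ⊕ t) ⨾ ∇ Q)
    ¡-nat : ∀ {P Q} (t : Tape 𝒮 P Q) → (¡ P ⨾ t) ≈T ¡ Q
    -- coherence with ⊕ (objects are lists, so coherence is stated along ∷)
    Δ-[] : Δ [] ≈T idT []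
    Δ-∷  : (U : Mono 𝒮) (P : Poly 𝒮) →
           Δ (U ∷ P) ≈T ((Δ (U ∷ []) ⊕ Δ P) ⨾ (idT (U ∷ []) ⊕ (σ⊕ (U ∷ []) P ⊕ idT P)))
    !-[] : ! [] ≈T idT []
    !-∷  : (U : Mono 𝒮) (P : Poly 𝒮) → ! (U ∷ P) ≈T (! (U ∷ []) ⊕ ! P)
    ∇-[] : ∇ [] ≈T idT []
    ∇-∷  : (U : Mono 𝒮) (P : Poly 𝒮) →
           ∇ (U ∷ P) ≈T ((idT (U ∷ []) ⊕ (σ⊕ P (U ∷ []) ⊕ idT P)) ⨾ (∇ (U ∷ []) ⊕ ∇ P))
    ¡-[] : ¡ [] ≈T idT []
    ¡-∷  : (U : Mono 𝒮) (P : Poly 𝒮) → ¡ (U ∷ P) ≈T (¡ (U ∷ []) ⊕ ¡ P)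

module _ {𝒮 : Signature} where

  coe : ∀ {P Q : Poly 𝒮} → P ≡ Q → Tape 𝒮 P Q
  coe {P} refl = idT P

  _⊠_ : Mono 𝒮 → Poly 𝒮 → Poly 𝒮
  U ⊠ Q = map (U ++_) Q

  infixr 7 _⊗P_
  _⊗P_ : Poly 𝒮 → Poly 𝒮 → Poly 𝒮
  [] ⊗P Q = []
  (U ∷ P) ⊗P Q = (U ⊠ Q) ++ (P ⊗P Q)

  ⊗P-++ : (P P' Q : Poly 𝒮) → (P ++ P') ⊗P Q ≡ (P ⊗P Q) ++ (P' ⊗P Q)
  ⊗P-++ [] P' Q = refl
  ⊗P-++ (U ∷ P) P' Q =
    trans (cong ((U ⊠ Q) ++_) (⊗P-++ P P' Q)) (sym (++-assoc (U ⊠ Q) (P ⊗P Q) (P' ⊗P Q)))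

  ⊗P-[] : (P : Poly 𝒮) → P ⊗P [] ≡ []
  ⊗P-[] [] = refl
  ⊗P-[] (U ∷ P) = ⊗P-[] P

  wl : (U : Mono 𝒮) → ∀ {P Q} → Tape 𝒮 P Q → Tape 𝒮 (U ⊠ P) (U ⊠ Q)
  wl U ⌈ c ⌉ = ⌈ idC U ⊗C c ⌉
  wl U (idT P) = idT (U ⊠ P)
  wl U (σ⊕ P Q) = coe (map-++ (U ++_) P Q) ⨾ σ⊕ (U ⊠ P) (U ⊠ Q) ⨾ coe (sym (map-++ (U ++_) Q P))
  wl U (Δ P) = Δ (U ⊠ P) ⨾ coe (sym (map-++ (U ++_) P P))
  wl U (! P) = ! (U ⊠ P)
  wl U (∇ P) = coe (map-++ (U ++_) P P) ⨾ ∇ (U ⊠ P)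
  wl U (¡ P) = ¡ (U ⊠ P)
  wl U (t ⨾ s) = wl U t ⨾ wl U s
  wl U (_⊕_ {P} {Q} {P'} {Q'} t s) =
    coe (map-++ (U ++_) P P') ⨾ (wl U t ⊕ wl U s) ⨾ coe (sym (map-++ (U ++_) Q Q'))

  wr : (V : Mono 𝒮) → ∀ {P Q} → Tape 𝒮 P Q → Tape 𝒮 (P ⊗P (V ∷ [])) (Q ⊗P (V ∷ []))
  wr V ⌈ c ⌉ = ⌈ c ⊗C idC V ⌉
  wr V (idT P) = idT (P ⊗P (V ∷ []))
  wr V (σ⊕ P Q) = coe (⊗P-++ P Q (V ∷ [])) ⨾ σ⊕ (P ⊗P (V ∷ [])) (Q ⊗P (V ∷ [])) ⨾ coe (sym (⊗P-++ Q P (V ∷ [])))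
  wr V (Δ P) = Δ (P ⊗P (V ∷ [])) ⨾ coe (sym (⊗P-++ P P (V ∷ [])))
  wr V (! P) = ! (P ⊗P (V ∷ []))
  wr V (∇ P) = coe (⊗P-++ P P (V ∷ [])) ⨾ ∇ (P ⊗P (V ∷ []))
  wr V (¡ P) = ¡ (P ⊗P (V ∷ []))
  wr V (t ⨾ s) = wr V t ⨾ wr V s
  wr V (_⊕_ {P} {Q} {P'} {Q'} t s) =
    coe (⊗P-++ P P' (V ∷ [])) ⨾ (wr V t ⊕ wr V s) ⨾ coe (sym (⊗P-++ Q Q' (V ∷ [])))

  δ : (P : Poly 𝒮) (V : Mono 𝒮) (Q : Poly 𝒮) → Tape 𝒮 (P ⊗P (V ∷ Q)) ((P ⊗P (V ∷ [])) ++ (P ⊗P Q))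
  δ [] V Q = idT []
  δ (U ∷ P) V Q =
    idT ((U ++ V) ∷ []) ⊕
      ((idT (U ⊠ Q) ⊕ δ P V Q)
       ⨾ coe (sym (++-assoc (U ⊠ Q) (P ⊗P (V ∷ [])) (P ⊗P Q)))
       ⨾ (σ⊕ (U ⊠ Q) (P ⊗P (V ∷ [])) ⊕ idT (P ⊗P Q))
       ⨾ coe (++-assoc (P ⊗P (V ∷ [])) (U ⊠ Q) (P ⊗P Q)))

  δ⁻ : (P : Poly 𝒮) (V : Mono 𝒮) (Q : Poly 𝒮) → Tape 𝒮 ((P ⊗P (V ∷ [])) ++ (P ⊗P Q)) (P ⊗P (V ∷ Q))
  δ⁻ [] V Q = idT []
  δ⁻ (U ∷ P) V Q =
    idT ((U ++ V) ∷ []) ⊕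
      (coe (sym (++-assoc (P ⊗P (V ∷ [])) (U ⊠ Q) (P ⊗P Q)))
       ⨾ (σ⊕ (P ⊗P (V ∷ [])) (U ⊠ Q) ⊕ idT (P ⊗P Q))
       ⨾ coe (++-assoc (U ⊠ Q) (P ⊗P (V ∷ [])) (P ⊗P Q))
       ⨾ (idT (U ⊠ Q) ⊕ δ⁻ P V Q))

  wlP : (P : Poly 𝒮) → ∀ {Q Q'} → Tape 𝒮 Q Q' → Tape 𝒮 (P ⊗P Q) (P ⊗P Q')
  wlP [] t = idT []
  wlP (U ∷ P) t = wl U t ⊕ wlP P t

  wrP : (Q : Poly 𝒮) → ∀ {P P'} → Tape 𝒮 P P' → Tape 𝒮 (P ⊗P Q) (P' ⊗P Q)
  wrP [] {P} {P'} t = coe (trans (⊗P-[] P) (sym (⊗P-[] P')))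
  wrP (V ∷ Q) {P} {P'} t = δ P V Q ⨾ (wr V t ⊕ wrP Q t) ⨾ δ⁻ P' V Q

  infixr 7 _⊗T_
  _⊗T_ : ∀ {P₁ Q₁ P₂ Q₂} → Tape 𝒮 P₁ Q₁ → Tape 𝒮 P₂ Q₂ → Tape 𝒮 (P₁ ⊗P P₂) (Q₁ ⊗P Q₂)
  _⊗T_ {P₁} {Q₁} {P₂} {Q₂} t₁ t₂ = wlP P₁ t₂ ⨾ wrP Q₂ t₁

  data LeT (𝕀 : Theory 𝒮) : ∀ {P Q} → Tape 𝒮 P Q → Tape 𝒮 P Q → Set where
    ax     : ∀ {u v} {c d : Circ 𝒮 u v} → 𝕀 c d → LeT 𝕀 ⌈ c ⌉ ⌈ d ⌉
    ¡!     : (U : Mono 𝒮) → LeT 𝕀 (idT []) (¡ (U ∷ []) ⨾ ! (U ∷ []))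
    !¡     : (U : Mono 𝒮) → LeT 𝕀 (! (U ∷ []) ⨾ ¡ (U ∷ [])) (idT (U ∷ []))
    ∇Δ     : (U : Mono 𝒮) → LeT 𝕀 (idT (U ∷ []) ⊕ idT (U ∷ [])) (∇ (U ∷ []) ⨾ Δ (U ∷ []))
    Δ∇     : (U : Mono 𝒮) → LeT 𝕀 (Δ (U ∷ []) ⨾ ∇ (U ∷ [])) (idT (U ∷ []))
    ≈⇒≤    : ∀ {P Q} {t s : Tape 𝒮 P Q} → t ≈T s → LeT 𝕀 t s
    ≤trans : ∀ {P Q} {t s r : Tape 𝒮 P Q} → LeT 𝕀 t s → LeT 𝕀 s r → LeT 𝕀 t r
    ⨾-mono : ∀ {P Q R} {t t' : Tape 𝒮 P Q} {s s' : Tape 𝒮 Q R} →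
             LeT 𝕀 t t' → LeT 𝕀 s s' → LeT 𝕀 (t ⨾ s) (t' ⨾ s')
    ⊕-mono : ∀ {P Q P' Q'} {t t' : Tape 𝒮 P Q} {s s' : Tape 𝒮 P' Q'} →
             LeT 𝕀 t t' → LeT 𝕀 s s' → LeT 𝕀 (t ⊕ s) (t' ⊕ s')
    ⊗-mono : ∀ {P Q P' Q'} {t t' : Tape 𝒮 P Q} {s s' : Tape 𝒮 P' Q'} →
             LeT 𝕀 t t' → LeT 𝕀 s s' → LeT 𝕀 (t ⊗T s) (t' ⊗T s')

  μ : (P : Poly 𝒮) (i : Fin (length P)) → Tape 𝒮 (lookup P i ∷ []) P
  μ (U ∷ P) zero = idT (U ∷ []) ⊕ ¡ P
  μ (U ∷ P) (suc i) = ¡ (U ∷ []) ⊕ μ P i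

  π : (Q : Poly 𝒮) (j : Fin (length Q)) → Tape 𝒮 Q (lookup Q j ∷ [])
  π (V ∷ Q) zero = idT (V ∷ []) ⊕ ! Q
  π (V ∷ Q) (suc j) = ! (V ∷ []) ⊕ π Q j

  infixl 6 _+T_
  _+T_ : ∀ {U V} → Tape 𝒮 (U ∷ []) (V ∷ []) → Tape 𝒮 (U ∷ []) (V ∷ []) → Tape 𝒮 (U ∷ []) (V ∷ [])
  _+T_ {U} {V} a b = Δ (U ∷ []) ⨾ (a ⊕ b) ⨾ ∇ (V ∷ [])

  𝔬 : ∀ {U V} → Tape 𝒮 (U ∷ []) (V ∷ [])
  𝔬 {U} {V} = ! (U ∷ []) ⨾ ¡ (V ∷ [])

  ∑ : ∀ {U V} → List (Circ 𝒮 U V) → Tape 𝒮 (U ∷ []) (V ∷ [])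
  ∑ [] = 𝔬
  ∑ (c ∷ cs) = ⌈ c ⌉ +T ∑ cs

  LeEM : (𝕀 : Theory 𝒮) → ∀ {U V} → Tape 𝒮 (U ∷ []) (V ∷ []) → Tape 𝒮 (U ∷ []) (V ∷ []) → Set
  LeEM 𝕀 {U} {V} a b =
    Σ[ cs ∈ List (Circ 𝒮 U V) ] Σ[ ds ∈ List (Circ 𝒮 U V) ] ((a ≈T ∑ cs) × (b ≈T ∑ ds) × All (λ c → Any (λ d → LeC 𝕀 c d) ds) cs)

-- Every tape t : P → Q is provably the ⊞-sum of its matrix of entries
-- π i ⨾ (μ i ⨾ t ⨾ π j) ⨾ μ j, and every entry between monomials is provably a
-- sum ∑ cs of circuits (its sum form).  Between monomials the axioms Δ∇ and !¡
-- make ⊞ a binary join and 𝔬 a least element for ≤Ĩ, so entrywise ≤^EM yields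
-- t ≤Ĩ s.  Conversely, a tape denotes, for each input position i and output
-- position j, a ≤𝕀-down-closed set of circuits; the entry of ∑ cs is the
-- down-closure of cs.  Every law of T_Σ holds in this semantics and every
-- generating inequality of ≤Ĩ, whiskerings included, is an inclusion, so
-- t ≤Ĩ s forces each circuit of the sum form of t's entry below some circuit
-- of the sum form of s's entry.

module Submission where

open import Defs
open import Data.Empty using (⊥; ⊥-elim)
open import Data.Fin using (Fin; zero; suc; toℕ)
open import Data.List using (List; []; _∷_; _++_; length; map; lookup)
open import Data.List.Properties using (length-++; length-map; ++-assoc; ++-identityʳ; map-++)
open import Data.List.Relation.Unary.All as All using (All; []; _∷_)
open import Data.List.Relation.Unary.Any as Any using (Any; here; there)
open import Data.Nat using (ℕ; zero; suc; pred; _+_; _<_; s≤s; z≤n)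
open import Data.Nat.Properties using (+-assoc; +-comm; +-identityʳ; +-cancelˡ-≡; +-cancelˡ-<; +-monoʳ-<; m+n≮m; m≤m+n; <-≤-trans; +-suc; m<m+n)
open import Data.Product using (Σ; _×_; _,_; proj₁; proj₂)
open import Data.Sum using (_⊎_; inj₁; inj₂)
open import Relation.Nullary using (¬_)
open import Function.Bundles using (_⇔_; mk⇔)
open import Relation.Binary.PropositionalEquality using (_≡_; refl; sym; trans; cong; subst; subst₂)

data At {A : Set} : List A → ℕ → A → Set where
  at0 : ∀ {x xs} → At (x ∷ xs) 0 x
  atS : ∀ {x y xs n} → At xs n x → At (y ∷ xs) (suc n) x

module _ {A : Set} where

  at-<length : {P : List A} {i : ℕ} {W : A} → At P i W → i < length P
  at-<length at0 = s≤s z≤n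
  at-<length (atS a) = s≤s (at-<length a)

  at-beyond : (P : List A) {i : ℕ} {W : A} → ¬ At P (length P + i) W
  at-beyond [] ()
  at-beyond (x ∷ P) (atS a) = at-beyond P a

  at-beyond-≡ : (P : List A) {i j : ℕ} {W : A} → i ≡ length P + j → ¬ At P i W
  at-beyond-≡ P refl = at-beyond P

  at-functional : {P : List A} {i : ℕ} {W W' : A} → At P i W → At P i W' → W ≡ W'
  at-functional at0 at0 = refl
  at-functional (atS a) (atS b) = at-functional a b

  at-++ˡ : {P Q : List A} {i : ℕ} {W : A} → At P i W → At (P ++ Q) i W
  at-++ˡ at0 = at0
  at-++ˡ (atS a) = atS (at-++ˡ a)

  at-++ʳ : (P : List A) {Q : List A} {i : ℕ} {W : A} → At Q i W → At (P ++ Q) (length P + i) W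
  at-++ʳ [] a = a
  at-++ʳ (x ∷ P) a = atS (at-++ʳ P a)

  at-++ˡ⁻ : (P : List A) {Q : List A} {i : ℕ} {W : A} → At (P ++ Q) i W → i < length P → At P i W
  at-++ˡ⁻ (x ∷ P) at0 lt = at0
  at-++ˡ⁻ (x ∷ P) (atS a) (s≤s lt) = atS (at-++ˡ⁻ P a lt)

  at-++ʳ⁻ : (P : List A) {Q : List A} {i : ℕ} {W : A} → At (P ++ Q) (length P + i) W → At Q i W
  at-++ʳ⁻ [] a = a
  at-++ʳ⁻ (x ∷ P) (atS a) = at-++ʳ⁻ P a

  at-<length-++ : (P Q : List A) {i : ℕ} {W : A} → At (P ++ Q) i W → i < length P + length Q
  at-<length-++ P Q a = subst (_ <_) (length-++ P) (at-<length a)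

  at-map : {B : Set} (f : A → B) {P : List A} {i : ℕ} {W : A} → At P i W → At (map f P) i (f W)
  at-map f at0 = at0
  at-map f (atS a) = atS (at-map f a)

  at-map⁻ : {B : Set} (f : A → B) {P : List A} {i : ℕ} {X : B} → At (map f P) i X →
            Σ A (λ W → (X ≡ f W) × At P i W)
  at-map⁻ f {x ∷ P} at0 = _ , refl , at0
  at-map⁻ f {x ∷ P} (atS a) with at-map⁻ f a
  ... | W , e , b = W , e , atS b

<⊎≡+ : (n i : ℕ) → (i < n) ⊎ Σ ℕ (λ j → i ≡ n + j)
<⊎≡+ zero i = inj₂ (i , refl)
<⊎≡+ (suc n) zero = inj₁ (s≤s z≤n)
<⊎≡+ (suc n) (suc i) with <⊎≡+ n i
... | inj₁ lt = inj₁ (s≤s lt)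
... | inj₂ (j , refl) = inj₂ (j , refl)

<⇒<+ : ∀ {i n} m → i < n → i < n + m
<⇒<+ {i} {n} m lt = <-≤-trans lt (m≤m+n n m)

-- Derived laws, sums and matrices of tapes

module _ {𝒮 : Signature} where
  private
    M : Set
    M = Mono 𝒮
    Pl : Set
    Pl = Poly 𝒮
    C : M → M → Set
    C = Circ 𝒮
    T : Pl → Pl → Set
    T = Tape 𝒮

  ≈C-endpoints : ∀ {u v u' v'} {c : Circ 𝒮 u v} {d : Circ 𝒮 u' v'} → c ≈C d → (u ≡ u') × (v ≡ v')
  ≈C-endpoints ≈refl = refl , refl
  ≈C-endpoints (≈sym e) with ≈C-endpoints e
  ... | refl , refl = refl , refl
  ≈C-endpoints (≈trans e f) with ≈C-endpoints e | ≈C-endpoints f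
  ... | refl , refl | refl , refl = refl , refl
  ≈C-endpoints (⨾-cong e f) with ≈C-endpoints e | ≈C-endpoints f
  ... | refl , refl | refl , refl = refl , refl
  ≈C-endpoints (⊗-cong e f) with ≈C-endpoints e | ≈C-endpoints f
  ... | refl , refl | refl , refl = refl , refl
  ≈C-endpoints (idˡ f) = refl , refl
  ≈C-endpoints (idʳ f) = refl , refl
  ≈C-endpoints (⨾-assoc f g h) = refl , refl
  ≈C-endpoints (⊗-assoc {u} {v} {w} {x} {y} {z} f g h) = ++-assoc u w y , ++-assoc v x z
  ≈C-endpoints (⊗-unitˡ f) = refl , refl
  ≈C-endpoints (⊗-unitʳ {u} {v} f) = ++-identityʳ u , ++-identityʳ v
  ≈C-endpoints (id⊗id u v) = refl , refl
  ≈C-endpoints (interchange f g f' g') = refl , refl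
  ≈C-endpoints (σ-nat f g) = refl , refl
  ≈C-endpoints (σ-inv u v) = refl , refl
  ≈C-endpoints (σ-unit u) = ++-identityʳ u , refl
  ≈C-endpoints (σ-hex u x w) = sym (++-assoc u (x ∷ []) w) , refl

  ≈T-endpoints : ∀ {P Q P' Q'} {t : Tape 𝒮 P Q} {s : Tape 𝒮 P' Q'} → t ≈T s → (P ≡ P') × (Q ≡ Q')
  ≈T-endpoints ≈refl = refl , refl
  ≈T-endpoints (≈sym e) with ≈T-endpoints e
  ... | refl , refl = refl , refl
  ≈T-endpoints (≈trans e f) with ≈T-endpoints e | ≈T-endpoints f
  ... | refl , refl | refl , refl = refl , refl
  ≈T-endpoints (⨾-cong e f) with ≈T-endpoints e | ≈T-endpoints f
  ... | refl , refl | refl , refl = refl , refl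
  ≈T-endpoints (⊕-cong e f) with ≈T-endpoints e | ≈T-endpoints f
  ... | refl , refl | refl , refl = refl , refl
  ≈T-endpoints (idˡ t) = refl , refl
  ≈T-endpoints (idʳ t) = refl , refl
  ≈T-endpoints (⨾-assoc t s r) = refl , refl
  ≈T-endpoints (⊕-assoc {P} {Q} {R} {S} {X} {Y} t s r) = ++-assoc P R X , ++-assoc Q S Y
  ≈T-endpoints (⊕-unitˡ t) = refl , refl
  ≈T-endpoints (⊕-unitʳ {P} {Q} t) = ++-identityʳ P , ++-identityʳ Q
  ≈T-endpoints (id⊕id P Q) = refl , refl
  ≈T-endpoints (interchange t s t' s') = refl , refl
  ≈T-endpoints (σ-nat t s) = refl , refl
  ≈T-endpoints (σ-inv P Q) = refl , refl
  ≈T-endpoints (σ-unit P) = ++-identityʳ P , refl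
  ≈T-endpoints (σ-hex P U R) = sym (++-assoc P (U ∷ []) R) , refl
  ≈T-endpoints (⌈⌉-cong e) with ≈C-endpoints e
  ... | refl , refl = refl , refl
  ≈T-endpoints (⌈id⌉ u) = refl , refl
  ≈T-endpoints (⌈⨾⌉ c d) = refl , refl
  ≈T-endpoints (∇-assoc P) = ++-assoc P P P , refl
  ≈T-endpoints (∇-unit P) = refl , refl
  ≈T-endpoints (∇-comm P) = refl , refl
  ≈T-endpoints (Δ-assoc P) = refl , ++-assoc P P P
  ≈T-endpoints (Δ-unit P) = refl , refl
  ≈T-endpoints (Δ-comm P) = refl , refl
  ≈T-endpoints (Δ-nat t) = refl , refl
  ≈T-endpoints (!-nat t) = refl , refl
  ≈T-endpoints (∇-nat t) = refl , refl
  ≈T-endpoints (¡-nat t) = refl , refl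
  ≈T-endpoints Δ-[] = refl , refl
  ≈T-endpoints (Δ-∷ U P) = refl , cong (U ∷_) (sym (++-assoc P (U ∷ []) P))
  ≈T-endpoints !-[] = refl , refl
  ≈T-endpoints (!-∷ U P) = refl , refl
  ≈T-endpoints ∇-[] = refl , refl
  ≈T-endpoints (∇-∷ U P) = cong (U ∷_) (sym (++-assoc P (U ∷ []) P)) , refl
  ≈T-endpoints ¡-[] = refl , refl
  ≈T-endpoints (¡-∷ U P) = refl , refl

  -- _≈T_ relates tapes of different types, so the standard reasoning modules do not apply.
  infix 1 begin_
  infixr 2 _≈⟨_⟩_ _≈˘⟨_⟩_
  infix 3 _∎
  begin_ : ∀ {P Q P' Q'} {x : T P Q} {y : T P' Q'} → x ≈T y → x ≈T y
  begin p = p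
  _≈⟨_⟩_ : ∀ {P Q P' Q' P'' Q''} (x : T P Q) {y : T P' Q'} {z : T P'' Q''} → x ≈T y → y ≈T z → x ≈T z
  x ≈⟨ p ⟩ q = ≈trans p q
  _≈˘⟨_⟩_ : ∀ {P Q P' Q' P'' Q''} (x : T P Q) {y : T P' Q'} {z : T P'' Q''} → y ≈T x → y ≈T z → x ≈T z
  x ≈˘⟨ p ⟩ q = ≈trans (≈sym p) q
  _∎ : ∀ {P Q} (x : T P Q) → x ≈T x
  x ∎ = ≈refl

  ⨾ˡ : ∀ {P Q R P'} {t : T P Q} {t' : T P' Q} {s : T Q R} → t ≈T t' → (t ⨾ s) ≈T (t' ⨾ s)
  ⨾ˡ e = ⨾-cong e ≈refl
  ⨾ʳ : ∀ {P Q R R'} {t : T P Q} {s : T Q R} {s' : T Q R'} → s ≈T s' → (t ⨾ s) ≈T (t ⨾ s')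
  ⨾ʳ e = ⨾-cong ≈refl e
  ⊕ˡ : ∀ {P Q P' Q' X Y} {t : T P Q} {t' : T X Y} {s : T P' Q'} → t ≈T t' → (t ⊕ s) ≈T (t' ⊕ s)
  ⊕ˡ e = ⊕-cong e ≈refl
  ⊕ʳ : ∀ {P Q P' Q' X Y} {t : T P Q} {s : T P' Q'} {s' : T X Y} → s ≈T s' → (t ⊕ s) ≈T (t ⊕ s')
  ⊕ʳ e = ⊕-cong ≈refl e

  assocˡ : ∀ {P Q R S} {t : T P Q} {s : T Q R} {r : T R S} → (t ⨾ (s ⨾ r)) ≈T ((t ⨾ s) ⨾ r)
  assocˡ = ≈sym (⨾-assoc _ _ _)

  coe≈ : ∀ {P Q : Pl} (e : P ≡ Q) → coe {𝒮} e ≈T idT P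
  coe≈ refl = ≈refl

  ⊕-as-⨾ : ∀ {P Q P' Q'} (t : T P Q) (s : T P' Q') → (t ⊕ s) ≈T ((t ⊕ idT P') ⨾ (idT Q ⊕ s))
  ⊕-as-⨾ t s = begin t ⊕ s ≈˘⟨ ⊕-cong (idʳ t) (idˡ s) ⟩ (t ⨾ idT _) ⊕ (idT _ ⨾ s) ≈⟨ interchange t (idT _) (idT _) s ⟩ _ ∎

  ⊕-as-⨾′ : ∀ {P Q P' Q'} (t : T P Q) (s : T P' Q') → (t ⊕ s) ≈T ((idT P ⊕ s) ⨾ (t ⊕ idT Q'))
  ⊕-as-⨾′ t s = begin t ⊕ s ≈˘⟨ ⊕-cong (idˡ t) (idʳ s) ⟩ (idT _ ⨾ t) ⊕ (s ⨾ idT _) ≈⟨ interchange (idT _) t s (idT _) ⟩ _ ∎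

  id-++[] : ∀ (P : Pl) → idT (P ++ []) ≈T idT {𝒮} P
  id-++[] P = ≈trans (≈sym (id⊕id P [])) (⊕-unitʳ (idT P))

  σ-[]ˡ : ∀ (P : Pl) → σ⊕ [] P ≈T idT P
  σ-[]ˡ P = begin
    σ⊕ [] P ≈˘⟨ idˡ _ ⟩
    idT P ⨾ σ⊕ [] P ≈˘⟨ ⨾ˡ (σ-unit P) ⟩
    σ⊕ P [] ⨾ σ⊕ [] P ≈⟨ σ-inv P [] ⟩
    idT (P ++ []) ≈⟨ id-++[] P ⟩
    idT P ∎

  Δ-unitʳ : ∀ (P : Pl) → (Δ P ⨾ (idT P ⊕ ! P)) ≈T idT P
  Δ-unitʳ P = begin
    Δ P ⨾ (idT P ⊕ ! P) ≈˘⟨ ⨾ˡ (Δ-comm P) ⟩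
    (Δ P ⨾ σ⊕ P P) ⨾ (idT P ⊕ ! P) ≈⟨ ⨾-assoc _ _ _ ⟩
    Δ P ⨾ (σ⊕ P P ⨾ (idT P ⊕ ! P)) ≈˘⟨ ⨾ʳ (σ-nat (! P) (idT P)) ⟩
    Δ P ⨾ ((! P ⊕ idT P) ⨾ σ⊕ [] P) ≈⟨ assocˡ ⟩
    (Δ P ⨾ (! P ⊕ idT P)) ⨾ σ⊕ [] P ≈⟨ ⨾-cong (Δ-unit P) (σ-[]ˡ P) ⟩
    idT P ⨾ idT P ≈⟨ idˡ _ ⟩
    idT P ∎

  ∇-unitʳ : ∀ (P : Pl) → ((idT P ⊕ ¡ P) ⨾ ∇ P) ≈T idT P
  ∇-unitʳ P = begin
    (idT P ⊕ ¡ P) ⨾ ∇ P ≈˘⟨ ⨾ʳ (∇-comm P) ⟩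
    (idT P ⊕ ¡ P) ⨾ (σ⊕ P P ⨾ ∇ P) ≈⟨ assocˡ ⟩
    ((idT P ⊕ ¡ P) ⨾ σ⊕ P P) ⨾ ∇ P ≈⟨ ⨾ˡ (σ-nat (idT P) (¡ P)) ⟩
    (σ⊕ P [] ⨾ (¡ P ⊕ idT P)) ⨾ ∇ P ≈⟨ ⨾-assoc _ _ _ ⟩
    σ⊕ P [] ⨾ ((¡ P ⊕ idT P) ⨾ ∇ P) ≈⟨ ⨾-cong (σ-unit P) (∇-unit P) ⟩
    idT P ⨾ idT P ≈⟨ idˡ _ ⟩
    idT P ∎

  ¡⨾! : ∀ (P : Pl) → (¡ P ⨾ ! P) ≈T idT {𝒮} []
  ¡⨾! P = ≈trans (¡-nat (! P)) ¡-[]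

  !⊕¡≈!⨾¡ : ∀ (P Q : Pl) → (! P ⊕ ¡ Q) ≈T (! P ⨾ ¡ Q)
  !⊕¡≈!⨾¡ P Q = begin
    ! P ⊕ ¡ Q ≈⟨ ⊕-as-⨾ (! P) (¡ Q) ⟩
    (! P ⊕ idT []) ⨾ (idT [] ⊕ ¡ Q) ≈⟨ ⨾-cong (⊕-unitʳ (! P)) (⊕-unitˡ (¡ Q)) ⟩
    ! P ⨾ ¡ Q ∎

  ¡⊕!≈!⨾¡ : ∀ (P Q : Pl) → (¡ P ⊕ ! Q) ≈T (! Q ⨾ ¡ P)
  ¡⊕!≈!⨾¡ P Q = begin
    ¡ P ⊕ ! Q ≈⟨ ⊕-as-⨾′ (¡ P) (! Q) ⟩
    (idT [] ⊕ ! Q) ⨾ (¡ P ⊕ idT []) ≈⟨ ⨾-cong (⊕-unitˡ (! Q)) (⊕-unitʳ (¡ P)) ⟩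
    ! Q ⨾ ¡ P ∎

  ¡-++ : ∀ (P P' : Pl) → ¡ (P ++ P') ≈T (¡ P ⊕ ¡ P')
  ¡-++ [] P' = begin ¡ P' ≈˘⟨ ⊕-unitˡ (¡ P') ⟩ idT [] ⊕ ¡ P' ≈˘⟨ ⊕ˡ ¡-[] ⟩ ¡ [] ⊕ ¡ P' ∎
  ¡-++ (U ∷ P) P' = begin
    ¡ (U ∷ P ++ P') ≈⟨ ¡-∷ U (P ++ P') ⟩
    ¡ (U ∷ []) ⊕ ¡ (P ++ P') ≈⟨ ⊕ʳ (¡-++ P P') ⟩
    ¡ (U ∷ []) ⊕ (¡ P ⊕ ¡ P') ≈˘⟨ ⊕-assoc _ _ _ ⟩
    (¡ (U ∷ []) ⊕ ¡ P) ⊕ ¡ P' ≈˘⟨ ⊕ˡ (¡-∷ U P) ⟩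
    ¡ (U ∷ P) ⊕ ¡ P' ∎

  !-++ : ∀ (P P' : Pl) → ! (P ++ P') ≈T (! P ⊕ ! P')
  !-++ [] P' = begin ! P' ≈˘⟨ ⊕-unitˡ (! P') ⟩ idT [] ⊕ ! P' ≈˘⟨ ⊕ˡ !-[] ⟩ ! [] ⊕ ! P' ∎
  !-++ (U ∷ P) P' = begin
    ! (U ∷ P ++ P') ≈⟨ !-∷ U (P ++ P') ⟩
    ! (U ∷ []) ⊕ ! (P ++ P') ≈⟨ ⊕ʳ (!-++ P P') ⟩
    ! (U ∷ []) ⊕ (! P ⊕ ! P') ≈˘⟨ ⊕-assoc _ _ _ ⟩
    (! (U ∷ []) ⊕ ! P) ⊕ ! P' ≈˘⟨ ⊕ˡ (!-∷ U P) ⟩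
    ! (U ∷ P) ⊕ ! P' ∎

  -- On monomials these are definitionally _+T_ and 𝔬.
  infixl 6 _⊞_
  _⊞_ : ∀ {P Q} → T P Q → T P Q → T P Q
  _⊞_ {P} {Q} a b = Δ P ⨾ (a ⊕ b) ⨾ ∇ Q

  𝟘 : ∀ {P Q} → T P Q
  𝟘 {P} {Q} = ! P ⨾ ¡ Q

  ⊞-cong : ∀ {P Q} {a a' b b' : T P Q} → a ≈T a' → b ≈T b' → (a ⊞ b) ≈T (a' ⊞ b')
  ⊞-cong e f = ⨾ʳ (⨾ˡ (⊕-cong e f))

  ⨾-distribˡ-⊞ : ∀ {P Q R} (f : T P Q) (a b : T Q R) → (f ⨾ (a ⊞ b)) ≈T ((f ⨾ a) ⊞ (f ⨾ b))
  ⨾-distribˡ-⊞ {P} {Q} {R} f a b = begin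
    f ⨾ (Δ Q ⨾ (a ⊕ b) ⨾ ∇ R) ≈⟨ assocˡ ⟩
    (f ⨾ Δ Q) ⨾ (a ⊕ b) ⨾ ∇ R ≈⟨ ⨾ˡ (Δ-nat f) ⟩
    (Δ P ⨾ (f ⊕ f)) ⨾ (a ⊕ b) ⨾ ∇ R ≈⟨ ⨾-assoc _ _ _ ⟩
    Δ P ⨾ (f ⊕ f) ⨾ (a ⊕ b) ⨾ ∇ R ≈⟨ ⨾ʳ assocˡ ⟩
    Δ P ⨾ ((f ⊕ f) ⨾ (a ⊕ b)) ⨾ ∇ R ≈˘⟨ ⨾ʳ (⨾ˡ (interchange f a f b)) ⟩
    Δ P ⨾ ((f ⨾ a) ⊕ (f ⨾ b)) ⨾ ∇ R ∎

  ⨾-distribʳ-⊞ : ∀ {P Q R} (a b : T P Q) (g : T Q R) → ((a ⊞ b) ⨾ g) ≈T ((a ⨾ g) ⊞ (b ⨾ g))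
  ⨾-distribʳ-⊞ {P} {Q} {R} a b g = begin
    (Δ P ⨾ (a ⊕ b) ⨾ ∇ Q) ⨾ g ≈⟨ ⨾-assoc _ _ _ ⟩
    Δ P ⨾ ((a ⊕ b) ⨾ ∇ Q) ⨾ g ≈⟨ ⨾ʳ (⨾-assoc _ _ _) ⟩
    Δ P ⨾ (a ⊕ b) ⨾ (∇ Q ⨾ g) ≈⟨ ⨾ʳ (⨾ʳ (∇-nat g)) ⟩
    Δ P ⨾ (a ⊕ b) ⨾ ((g ⊕ g) ⨾ ∇ R) ≈⟨ ⨾ʳ assocˡ ⟩
    Δ P ⨾ ((a ⊕ b) ⨾ (g ⊕ g)) ⨾ ∇ R ≈˘⟨ ⨾ʳ (⨾ˡ (interchange a g b g)) ⟩
    Δ P ⨾ ((a ⨾ g) ⊕ (b ⨾ g)) ⨾ ∇ R ∎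

  ⨾-zeroʳ : ∀ {P Q R} (f : T P Q) → (f ⨾ 𝟘 {Q} {R}) ≈T 𝟘 {P} {R}
  ⨾-zeroʳ f = ≈trans assocˡ (⨾ˡ (!-nat f))

  ⨾-zeroˡ : ∀ {P Q R} (g : T Q R) → (𝟘 {P} {Q} ⨾ g) ≈T 𝟘 {P} {R}
  ⨾-zeroˡ g = ≈trans (⨾-assoc _ _ _) (⨾ʳ (¡-nat g))

  ⊞-comm : ∀ {P Q} (a b : T P Q) → (a ⊞ b) ≈T (b ⊞ a)
  ⊞-comm {P} {Q} a b = begin
    Δ P ⨾ (a ⊕ b) ⨾ ∇ Q ≈˘⟨ ⨾ʳ (⨾ʳ (∇-comm Q)) ⟩
    Δ P ⨾ (a ⊕ b) ⨾ (σ⊕ Q Q ⨾ ∇ Q) ≈⟨ ⨾ʳ assocˡ ⟩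
    Δ P ⨾ ((a ⊕ b) ⨾ σ⊕ Q Q) ⨾ ∇ Q ≈⟨ ⨾ʳ (⨾ˡ (σ-nat a b)) ⟩
    Δ P ⨾ (σ⊕ P P ⨾ (b ⊕ a)) ⨾ ∇ Q ≈⟨ ⨾ʳ (⨾-assoc _ _ _) ⟩
    Δ P ⨾ σ⊕ P P ⨾ (b ⊕ a) ⨾ ∇ Q ≈⟨ assocˡ ⟩
    (Δ P ⨾ σ⊕ P P) ⨾ (b ⊕ a) ⨾ ∇ Q ≈⟨ ⨾ˡ (Δ-comm P) ⟩
    Δ P ⨾ (b ⊕ a) ⨾ ∇ Q ∎

  ⊞-unitʳ : ∀ {P Q} (a : T P Q) → (a ⊞ 𝟘) ≈T a
  ⊞-unitʳ {P} {Q} a = begin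
    Δ P ⨾ (a ⊕ (! P ⨾ ¡ Q)) ⨾ ∇ Q ≈˘⟨ ⨾ʳ (⨾ˡ (⊕-cong (≈trans (idˡ (a ⨾ idT Q)) (idʳ a)) (⨾ʳ (idˡ (¡ Q))))) ⟩
    Δ P ⨾ ((idT P ⨾ (a ⨾ idT Q)) ⊕ (! P ⨾ (idT [] ⨾ ¡ Q))) ⨾ ∇ Q ≈⟨ ⨾ʳ (⨾ˡ (interchange _ _ _ _)) ⟩
    Δ P ⨾ ((idT P ⊕ ! P) ⨾ ((a ⨾ idT Q) ⊕ (idT [] ⨾ ¡ Q))) ⨾ ∇ Q ≈⟨ ⨾ʳ (⨾ˡ (⨾ʳ (interchange _ _ _ _))) ⟩
    Δ P ⨾ ((idT P ⊕ ! P) ⨾ ((a ⊕ idT []) ⨾ (idT Q ⊕ ¡ Q))) ⨾ ∇ Q ≈⟨ ⨾ʳ (⨾-assoc _ _ _) ⟩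
    Δ P ⨾ (idT P ⊕ ! P) ⨾ ((a ⊕ idT []) ⨾ (idT Q ⊕ ¡ Q)) ⨾ ∇ Q ≈⟨ ⨾ʳ (⨾ʳ (⨾-assoc _ _ _)) ⟩
    Δ P ⨾ (idT P ⊕ ! P) ⨾ (a ⊕ idT []) ⨾ (idT Q ⊕ ¡ Q) ⨾ ∇ Q ≈⟨ assocˡ ⟩
    (Δ P ⨾ (idT P ⊕ ! P)) ⨾ (a ⊕ idT []) ⨾ ((idT Q ⊕ ¡ Q) ⨾ ∇ Q) ≈⟨ ⨾-cong (Δ-unitʳ P) (⨾-cong (⊕-unitʳ a) (∇-unitʳ Q)) ⟩
    idT P ⨾ a ⨾ idT Q ≈⟨ idˡ _ ⟩
    a ⨾ idT Q ≈⟨ idʳ a ⟩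
    a ∎

  ⊞-unitˡ : ∀ {P Q} (a : T P Q) → (𝟘 ⊞ a) ≈T a
  ⊞-unitˡ a = ≈trans (⊞-comm 𝟘 a) (⊞-unitʳ a)

  ⊕-interchange₃ : ∀ {P Q P' Q' P'' X Y Z} (f : T X P) (t : T P Q) (g : T Q Y) (f' : T Z P') (t' : T P' Q') (g' : T Q' P'') →
        ((f ⨾ t ⨾ g) ⊕ (f' ⨾ t' ⨾ g')) ≈T ((f ⊕ f') ⨾ (t ⊕ t') ⨾ (g ⊕ g'))
  ⊕-interchange₃ f t g f' t' g' = ≈trans (interchange f (t ⨾ g) f' (t' ⨾ g')) (⨾ʳ (interchange t g t' g'))

  ⊞-assoc : ∀ {P Q} (a b c : T P Q) → ((a ⊞ b) ⊞ c) ≈T (a ⊞ (b ⊞ c))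
  ⊞-assoc {P} {Q} a b c = begin
    Δ P ⨾ ((Δ P ⨾ (a ⊕ b) ⨾ ∇ Q) ⊕ c) ⨾ ∇ Q ≈˘⟨ ⨾ʳ (⨾ˡ (⊕ʳ (≈trans (idˡ _) (idʳ c)))) ⟩
    Δ P ⨾ ((Δ P ⨾ (a ⊕ b) ⨾ ∇ Q) ⊕ (idT P ⨾ c ⨾ idT Q)) ⨾ ∇ Q ≈⟨ ⨾ʳ (⨾ˡ (⊕-interchange₃ _ _ _ _ _ _)) ⟩
    Δ P ⨾ ((Δ P ⊕ idT P) ⨾ ((a ⊕ b) ⊕ c) ⨾ (∇ Q ⊕ idT Q)) ⨾ ∇ Q ≈⟨ ⨾ʳ (⨾-assoc _ _ _) ⟩
    Δ P ⨾ (Δ P ⊕ idT P) ⨾ (((a ⊕ b) ⊕ c) ⨾ (∇ Q ⊕ idT Q)) ⨾ ∇ Q ≈⟨ ⨾ʳ (⨾ʳ (⨾-assoc _ _ _)) ⟩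
    Δ P ⨾ (Δ P ⊕ idT P) ⨾ ((a ⊕ b) ⊕ c) ⨾ (∇ Q ⊕ idT Q) ⨾ ∇ Q ≈⟨ assocˡ ⟩
    (Δ P ⨾ (Δ P ⊕ idT P)) ⨾ ((a ⊕ b) ⊕ c) ⨾ ((∇ Q ⊕ idT Q) ⨾ ∇ Q) ≈⟨ ⨾-cong (Δ-assoc P) (⨾-cong (⊕-assoc a b c) (∇-assoc Q)) ⟩
    (Δ P ⨾ (idT P ⊕ Δ P)) ⨾ (a ⊕ (b ⊕ c)) ⨾ ((idT Q ⊕ ∇ Q) ⨾ ∇ Q) ≈⟨ ⨾-assoc _ _ _ ⟩
    Δ P ⨾ (idT P ⊕ Δ P) ⨾ (a ⊕ (b ⊕ c)) ⨾ ((idT Q ⊕ ∇ Q) ⨾ ∇ Q) ≈⟨ ⨾ʳ (⨾ʳ assocˡ) ⟩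
    Δ P ⨾ (idT P ⊕ Δ P) ⨾ ((a ⊕ (b ⊕ c)) ⨾ (idT Q ⊕ ∇ Q)) ⨾ ∇ Q ≈⟨ ⨾ʳ assocˡ ⟩
    Δ P ⨾ ((idT P ⊕ Δ P) ⨾ (a ⊕ (b ⊕ c)) ⨾ (idT Q ⊕ ∇ Q)) ⨾ ∇ Q ≈˘⟨ ⨾ʳ (⨾ˡ (⊕-interchange₃ _ _ _ _ _ _)) ⟩
    Δ P ⨾ ((idT P ⨾ a ⨾ idT Q) ⊕ (Δ P ⨾ (b ⊕ c) ⨾ ∇ Q)) ⨾ ∇ Q ≈⟨ ⨾ʳ (⨾ˡ (⊕ˡ (≈trans (idˡ _) (idʳ a)))) ⟩
    Δ P ⨾ (a ⊕ (Δ P ⨾ (b ⊕ c) ⨾ ∇ Q)) ⨾ ∇ Q ∎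

  σ-conjugate : ∀ {U U' : M} {P Q : Pl} (b : T P Q) (c : T (U ∷ []) (U' ∷ [])) →
           (σ⊕ (U ∷ []) P ⨾ (b ⊕ c) ⨾ σ⊕ Q (U' ∷ [])) ≈T (c ⊕ b)
  σ-conjugate {U} {U'} {P} {Q} b c = begin
    σ⊕ (U ∷ []) P ⨾ (b ⊕ c) ⨾ σ⊕ Q (U' ∷ []) ≈⟨ ⨾ʳ (σ-nat b c) ⟩
    σ⊕ (U ∷ []) P ⨾ σ⊕ P (U ∷ []) ⨾ (c ⊕ b) ≈⟨ assocˡ ⟩
    (σ⊕ (U ∷ []) P ⨾ σ⊕ P (U ∷ [])) ⨾ (c ⊕ b) ≈⟨ ⨾ˡ (σ-inv (U ∷ []) P) ⟩
    idT (U ∷ P) ⨾ (c ⊕ b) ≈⟨ idˡ _ ⟩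
    c ⊕ b ∎

  ⊞-⊕-interchange : ∀ {U U' : M} {P Q : Pl} (a c : T (U ∷ []) (U' ∷ [])) (b d : T P Q) →
       ((a ⊕ b) ⊞ (c ⊕ d)) ≈T ((a ⊞ c) ⊕ (b ⊞ d))
  ⊞-⊕-interchange {U} {U'} {P} {Q} a c b d = begin
    Δ (U ∷ P) ⨾ ((a ⊕ b) ⊕ (c ⊕ d)) ⨾ ∇ (U' ∷ Q)
      ≈⟨ ⨾-cong (Δ-∷ U P) (⨾-cong X≈ (∇-∷ U' Q)) ⟩
    ((Δ (U ∷ []) ⊕ Δ P) ⨾ S1) ⨾ (a ⊕ ((b ⊕ c) ⊕ d)) ⨾ (S2 ⨾ (∇ (U' ∷ []) ⊕ ∇ Q))
      ≈⟨ ⨾-assoc _ _ _ ⟩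
    (Δ (U ∷ []) ⊕ Δ P) ⨾ S1 ⨾ (a ⊕ ((b ⊕ c) ⊕ d)) ⨾ (S2 ⨾ (∇ (U' ∷ []) ⊕ ∇ Q))
      ≈⟨ ⨾ʳ (⨾ʳ assocˡ) ⟩
    (Δ (U ∷ []) ⊕ Δ P) ⨾ S1 ⨾ ((a ⊕ ((b ⊕ c) ⊕ d)) ⨾ S2) ⨾ (∇ (U' ∷ []) ⊕ ∇ Q)
      ≈⟨ ⨾ʳ assocˡ ⟩
    (Δ (U ∷ []) ⊕ Δ P) ⨾ (S1 ⨾ ((a ⊕ ((b ⊕ c) ⊕ d)) ⨾ S2)) ⨾ (∇ (U' ∷ []) ⊕ ∇ Q)
      ≈⟨ ⨾ʳ (⨾ˡ mid) ⟩
    (Δ (U ∷ []) ⊕ Δ P) ⨾ ((a ⊕ c) ⊕ (b ⊕ d)) ⨾ (∇ (U' ∷ []) ⊕ ∇ Q)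
      ≈˘⟨ ⊕-interchange₃ _ _ _ _ _ _ ⟩
    (a ⊞ c) ⊕ (b ⊞ d) ∎
    where
    S1 = idT (U ∷ []) ⊕ (σ⊕ (U ∷ []) P ⊕ idT P)
    S2 = idT (U' ∷ []) ⊕ (σ⊕ Q (U' ∷ []) ⊕ idT Q)
    X≈ : ((a ⊕ b) ⊕ (c ⊕ d)) ≈T (a ⊕ ((b ⊕ c) ⊕ d))
    X≈ = ≈trans (⊕-assoc a b (c ⊕ d)) (⊕ʳ (≈sym (⊕-assoc b c d)))
    mid : (S1 ⨾ ((a ⊕ ((b ⊕ c) ⊕ d)) ⨾ S2)) ≈T ((a ⊕ c) ⊕ (b ⊕ d))
    mid = begin
      S1 ⨾ (a ⊕ ((b ⊕ c) ⊕ d)) ⨾ S2 ≈˘⟨ ⊕-interchange₃ _ _ _ _ _ _ ⟩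
      (idT (U ∷ []) ⨾ a ⨾ idT (U' ∷ [])) ⊕ ((σ⊕ (U ∷ []) P ⊕ idT P) ⨾ ((b ⊕ c) ⊕ d) ⨾ (σ⊕ Q (U' ∷ []) ⊕ idT Q))
        ≈⟨ ⊕-cong (≈trans (idˡ _) (idʳ a)) (≈sym (⊕-interchange₃ _ _ _ _ _ _)) ⟩
      a ⊕ ((σ⊕ (U ∷ []) P ⨾ (b ⊕ c) ⨾ σ⊕ Q (U' ∷ [])) ⊕ (idT P ⨾ d ⨾ idT Q))
        ≈⟨ ⊕ʳ (⊕-cong (σ-conjugate b c) (≈trans (idˡ _) (idʳ d))) ⟩
      a ⊕ ((c ⊕ b) ⊕ d) ≈⟨ ⊕ʳ (⊕-assoc c b d) ⟩
      a ⊕ (c ⊕ (b ⊕ d)) ≈˘⟨ ⊕-assoc a c (b ⊕ d) ⟩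
      (a ⊕ c) ⊕ (b ⊕ d) ∎

  𝟘-∷ : ∀ {U U' : M} {P Q : Pl} → 𝟘 {U ∷ P} {U' ∷ Q} ≈T (𝟘 {U ∷ []} {U' ∷ []} ⊕ 𝟘 {P} {Q})
  𝟘-∷ {U} {U'} {P} {Q} = ≈trans (⨾-cong (!-∷ U P) (¡-∷ U' Q)) (≈sym (interchange _ _ _ _))

  Σ⊞ : ∀ {X Y} (L : Pl) → (Fin (length L) → T X Y) → T X Y
  Σ⊞ [] f = 𝟘
  Σ⊞ (U ∷ L) f = f zero ⊞ Σ⊞ L (λ i → f (suc i))

  Σ⊞-cong : ∀ {X Y} (L : Pl) {f g : Fin (length L) → T X Y} → (∀ i → f i ≈T g i) → Σ⊞ L f ≈T Σ⊞ L g
  Σ⊞-cong [] h = ≈refl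
  Σ⊞-cong (U ∷ L) h = ⊞-cong (h zero) (Σ⊞-cong L (λ i → h (suc i)))

  ⨾-distribˡ-Σ⊞ : ∀ {X Y Z} (L : Pl) (f : T X Y) (g : Fin (length L) → T Y Z) → (f ⨾ Σ⊞ L g) ≈T Σ⊞ L (λ i → f ⨾ g i)
  ⨾-distribˡ-Σ⊞ [] f g = ⨾-zeroʳ f
  ⨾-distribˡ-Σ⊞ (U ∷ L) f g = ≈trans (⨾-distribˡ-⊞ f _ _) (⊞-cong ≈refl (⨾-distribˡ-Σ⊞ L f (λ i → g (suc i))))

  ⨾-distribʳ-Σ⊞ : ∀ {X Y Z} (L : Pl) (g : Fin (length L) → T X Y) (h : T Y Z) → (Σ⊞ L g ⨾ h) ≈T Σ⊞ L (λ i → g i ⨾ h)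
  ⨾-distribʳ-Σ⊞ [] g h = ⨾-zeroˡ h
  ⨾-distribʳ-Σ⊞ (U ∷ L) g h = ≈trans (⨾-distribʳ-⊞ _ _ h) (⊞-cong ≈refl (⨾-distribʳ-Σ⊞ L (λ i → g (suc i)) h))

  Σ⊞-𝟘⊕ : ∀ {U U' : M} {P Q : Pl} (L : Pl) (g : Fin (length L) → T P Q) →
         Σ⊞ L (λ i → 𝟘 {U ∷ []} {U' ∷ []} ⊕ g i) ≈T (𝟘 {U ∷ []} {U' ∷ []} ⊕ Σ⊞ L g)
  Σ⊞-𝟘⊕ [] g = 𝟘-∷
  Σ⊞-𝟘⊕ (V ∷ L) g = begin
    (𝟘 ⊕ g zero) ⊞ Σ⊞ L (λ i → 𝟘 ⊕ g (suc i)) ≈⟨ ⊞-cong ≈refl (Σ⊞-𝟘⊕ L (λ i → g (suc i))) ⟩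
    (𝟘 ⊕ g zero) ⊞ (𝟘 ⊕ Σ⊞ L (λ i → g (suc i))) ≈⟨ ⊞-⊕-interchange _ _ _ _ ⟩
    (𝟘 ⊞ 𝟘) ⊕ (g zero ⊞ Σ⊞ L (λ i → g (suc i))) ≈⟨ ⊕ˡ (⊞-unitˡ 𝟘) ⟩
    𝟘 ⊕ (g zero ⊞ Σ⊞ L (λ i → g (suc i))) ∎

  id≈Σ⊞π⨾μ : ∀ (P : Pl) → idT P ≈T Σ⊞ P (λ i → π P i ⨾ μ P i)
  id≈Σ⊞π⨾μ [] = ≈sym (≈trans (⨾-cong !-[] ¡-[]) (idˡ _))
  id≈Σ⊞π⨾μ (U ∷ P) = ≈sym (begin
    ((idT (U ∷ []) ⊕ ! P) ⨾ (idT (U ∷ []) ⊕ ¡ P)) ⊞ Σ⊞ P (λ i → (! (U ∷ []) ⊕ π P i) ⨾ (¡ (U ∷ []) ⊕ μ P i))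
      ≈⟨ ⊞-cong (≈sym (interchange _ _ _ _)) (Σ⊞-cong P (λ i → ≈sym (interchange _ _ _ _))) ⟩
    ((idT (U ∷ []) ⨾ idT (U ∷ [])) ⊕ 𝟘) ⊞ Σ⊞ P (λ i → 𝟘 ⊕ (π P i ⨾ μ P i))
      ≈⟨ ⊞-cong (⊕ˡ (idˡ _)) (Σ⊞-𝟘⊕ P _) ⟩
    (idT (U ∷ []) ⊕ 𝟘) ⊞ (𝟘 ⊕ Σ⊞ P (λ i → π P i ⨾ μ P i)) ≈⟨ ⊞-⊕-interchange _ _ _ _ ⟩
    (idT (U ∷ []) ⊞ 𝟘) ⊕ (𝟘 ⊞ Σ⊞ P (λ i → π P i ⨾ μ P i)) ≈⟨ ⊕-cong (⊞-unitʳ _) (⊞-unitˡ _) ⟩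
    idT (U ∷ []) ⊕ Σ⊞ P (λ i → π P i ⨾ μ P i) ≈˘⟨ ⊕ʳ (id≈Σ⊞π⨾μ P) ⟩
    idT (U ∷ []) ⊕ idT P ≈⟨ id⊕id _ _ ⟩
    idT (U ∷ P) ∎)

  matrix-decomposition : ∀ {P Q} (t : T P Q) → t ≈T Σ⊞ P (λ i → Σ⊞ Q (λ j → π P i ⨾ (μ P i ⨾ t ⨾ π Q j) ⨾ μ Q j))
  matrix-decomposition {P} {Q} t = begin
    t ≈˘⟨ idˡ t ⟩
    idT P ⨾ t ≈⟨ ⨾ˡ (id≈Σ⊞π⨾μ P) ⟩
    Σ⊞ P (λ i → π P i ⨾ μ P i) ⨾ t ≈⟨ ⨾-distribʳ-Σ⊞ P _ t ⟩
    Σ⊞ P (λ i → (π P i ⨾ μ P i) ⨾ t) ≈⟨ Σ⊞-cong P (λ i → inner i) ⟩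
    Σ⊞ P (λ i → Σ⊞ Q (λ j → π P i ⨾ (μ P i ⨾ t ⨾ π Q j) ⨾ μ Q j)) ∎
    where
    inner : ∀ i → ((π P i ⨾ μ P i) ⨾ t) ≈T Σ⊞ Q (λ j → π P i ⨾ (μ P i ⨾ t ⨾ π Q j) ⨾ μ Q j)
    inner i = begin
      (π P i ⨾ μ P i) ⨾ t ≈˘⟨ idʳ _ ⟩
      ((π P i ⨾ μ P i) ⨾ t) ⨾ idT Q ≈⟨ ⨾ʳ (id≈Σ⊞π⨾μ Q) ⟩
      ((π P i ⨾ μ P i) ⨾ t) ⨾ Σ⊞ Q (λ j → π Q j ⨾ μ Q j) ≈⟨ ⨾-distribˡ-Σ⊞ Q _ _ ⟩
      Σ⊞ Q (λ j → ((π P i ⨾ μ P i) ⨾ t) ⨾ (π Q j ⨾ μ Q j)) ≈⟨ Σ⊞-cong Q (λ j → re j) ⟩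
      Σ⊞ Q (λ j → π P i ⨾ (μ P i ⨾ t ⨾ π Q j) ⨾ μ Q j) ∎
      where
      re : ∀ j → (((π P i ⨾ μ P i) ⨾ t) ⨾ (π Q j ⨾ μ Q j)) ≈T (π P i ⨾ (μ P i ⨾ t ⨾ π Q j) ⨾ μ Q j)
      re j = begin
        ((π P i ⨾ μ P i) ⨾ t) ⨾ (π Q j ⨾ μ Q j) ≈⟨ ⨾-assoc _ _ _ ⟩
        (π P i ⨾ μ P i) ⨾ (t ⨾ (π Q j ⨾ μ Q j)) ≈⟨ ⨾-assoc _ _ _ ⟩
        π P i ⨾ μ P i ⨾ t ⨾ π Q j ⨾ μ Q j ≈⟨ ⨾ʳ (⨾ʳ assocˡ) ⟩
        π P i ⨾ μ P i ⨾ (t ⨾ π Q j) ⨾ μ Q j ≈⟨ ⨾ʳ assocˡ ⟩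
        π P i ⨾ (μ P i ⨾ t ⨾ π Q j) ⨾ μ Q j ∎

  ∑-++ : ∀ {U V} (cs ds : List (C U V)) → ∑ (cs ++ ds) ≈T (∑ cs ⊞ ∑ ds)
  ∑-++ [] ds = ≈sym (⊞-unitˡ (∑ ds))
  ∑-++ (c ∷ cs) ds = ≈trans (⊞-cong ≈refl (∑-++ cs ds)) (≈sym (⊞-assoc ⌈ c ⌉ (∑ cs) (∑ ds)))

  ⌈⌉⨾∑≈∑map : ∀ {U V W} (c : C U V) (ds : List (C V W)) → (⌈ c ⌉ ⨾ ∑ ds) ≈T ∑ (map (c ⨾C_) ds)
  ⌈⌉⨾∑≈∑map c [] = ⨾-zeroʳ ⌈ c ⌉
  ⌈⌉⨾∑≈∑map c (d ∷ ds) = ≈trans (⨾-distribˡ-⊞ ⌈ c ⌉ ⌈ d ⌉ (∑ ds)) (⊞-cong (≈sym (⌈⨾⌉ c d)) (⌈⌉⨾∑≈∑map c ds))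

  products : ∀ {U V W} → List (C U V) → List (C V W) → List (C U W)
  products [] ds = []
  products (c ∷ cs) ds = map (c ⨾C_) ds ++ products cs ds

  ∑⨾∑≈∑products : ∀ {U V W} (cs : List (C U V)) (ds : List (C V W)) → (∑ cs ⨾ ∑ ds) ≈T ∑ (products cs ds)
  ∑⨾∑≈∑products [] ds = ⨾-zeroˡ (∑ ds)
  ∑⨾∑≈∑products (c ∷ cs) ds = begin
    (⌈ c ⌉ ⊞ ∑ cs) ⨾ ∑ ds ≈⟨ ⨾-distribʳ-⊞ _ _ _ ⟩
    (⌈ c ⌉ ⨾ ∑ ds) ⊞ (∑ cs ⨾ ∑ ds) ≈⟨ ⊞-cong (⌈⌉⨾∑≈∑map c ds) (∑⨾∑≈∑products cs ds) ⟩
    ∑ (map (c ⨾C_) ds) ⊞ ∑ (products cs ds) ≈˘⟨ ∑-++ _ _ ⟩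
    ∑ (products (c ∷ cs) ds) ∎

  concat[] : ∀ {U V} (L : Pl) → (Fin (length L) → List (C U V)) → List (C U V)
  concat[] [] f = []
  concat[] (X ∷ L) f = f zero ++ concat[] L (λ i → f (suc i))

  Σ⊞-∑ : ∀ {U V} (L : Pl) (f : Fin (length L) → T (U ∷ []) (V ∷ [])) (cs : Fin (length L) → List (C U V)) →
         (∀ i → f i ≈T ∑ (cs i)) → Σ⊞ L f ≈T ∑ (concat[] L cs)
  Σ⊞-∑ [] f cs h = ≈refl
  Σ⊞-∑ (X ∷ L) f cs h = ≈trans (⊞-cong (h zero) (Σ⊞-∑ L _ _ (λ i → h (suc i)))) (≈sym (∑-++ (cs zero) _))

  -- Sum forms of matrix entries

  μ-at : ∀ {P : Pl} {n W} → At P n W → T (W ∷ []) P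
  μ-at {U ∷ P} at0 = idT (U ∷ []) ⊕ ¡ P
  μ-at {Y ∷ P} (atS a) = ¡ (Y ∷ []) ⊕ μ-at a

  π-at : ∀ {P : Pl} {n W} → At P n W → T P (W ∷ [])
  π-at {U ∷ P} at0 = idT (U ∷ []) ⊕ ! P
  π-at {Y ∷ P} (atS a) = ! (Y ∷ []) ⊕ π-at a

  at-lookup : ∀ {P : Pl} (i : Fin (length P)) → At P (toℕ i) (lookup P i)
  at-lookup {U ∷ P} zero = at0
  at-lookup {U ∷ P} (suc i) = atS (at-lookup i)

  μ≡μ-at : ∀ (P : Pl) (i : Fin (length P)) → μ P i ≡ μ-at (at-lookup i)
  μ≡μ-at (U ∷ P) zero = refl
  μ≡μ-at (U ∷ P) (suc i) = cong (¡ (U ∷ []) ⊕_) (μ≡μ-at P i)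

  π≡π-at : ∀ (P : Pl) (i : Fin (length P)) → π P i ≡ π-at (at-lookup i)
  π≡π-at (U ∷ P) zero = refl
  π≡π-at (U ∷ P) (suc i) = cong (! (U ∷ []) ⊕_) (π≡π-at P i)

  data At++View (P P' : Pl) : ∀ {n W} → At (P ++ P') n W → Set where
    inˡ : ∀ {n W} (a : At P n W) → At++View P P' (at-++ˡ a)
    inʳ : ∀ {n W} (a : At P' n W) → At++View P P' (at-++ʳ P a)

  at++-view : ∀ (P : Pl) {P' n W} (a : At (P ++ P') n W) → At++View P P' a
  at++-view [] a = inʳ a
  at++-view (U ∷ P) at0 = inˡ at0
  at++-view (U ∷ P) (atS a) with at++-view P a
  ... | inˡ b = inˡ (atS b)
  ... | inʳ b = inʳ b

  μ-at-++ˡ : ∀ {P P' : Pl} {n W} (a : At P n W) → μ-at (at-++ˡ {Q = P'} a) ≈T (μ-at a ⊕ ¡ P')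
  μ-at-++ˡ {U ∷ P} {P'} at0 = ≈trans (⊕ʳ (¡-++ P P')) (≈sym (⊕-assoc _ _ _))
  μ-at-++ˡ {Y ∷ P} {P'} (atS a) = ≈trans (⊕ʳ (μ-at-++ˡ a)) (≈sym (⊕-assoc _ _ _))

  μ-at-++ʳ : ∀ (P : Pl) {P' : Pl} {n W} (a : At P' n W) → μ-at (at-++ʳ P a) ≈T (¡ P ⊕ μ-at a)
  μ-at-++ʳ [] a = ≈sym (≈trans (⊕ˡ ¡-[]) (⊕-unitˡ _))
  μ-at-++ʳ (U ∷ P) a = ≈trans (⊕ʳ (μ-at-++ʳ P a)) (≈trans (≈sym (⊕-assoc _ _ _)) (⊕ˡ (≈sym (¡-∷ U P))))

  π-at-++ˡ : ∀ {P P' : Pl} {n W} (a : At P n W) → π-at (at-++ˡ {Q = P'} a) ≈T (π-at a ⊕ ! P')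
  π-at-++ˡ {U ∷ P} {P'} at0 = ≈trans (⊕ʳ (!-++ P P')) (≈sym (⊕-assoc _ _ _))
  π-at-++ˡ {Y ∷ P} {P'} (atS a) = ≈trans (⊕ʳ (π-at-++ˡ a)) (≈sym (⊕-assoc _ _ _))

  π-at-++ʳ : ∀ (P : Pl) {P' : Pl} {n W} (a : At P' n W) → π-at (at-++ʳ P a) ≈T (! P ⊕ π-at a)
  π-at-++ʳ [] a = ≈sym (≈trans (⊕ˡ !-[]) (⊕-unitˡ _))
  π-at-++ʳ (U ∷ P) a = ≈trans (⊕ʳ (π-at-++ʳ P a)) (≈trans (≈sym (⊕-assoc _ _ _)) (⊕ˡ (≈sym (!-∷ U P))))

  SumForm : ∀ {U V} → T (U ∷ []) (V ∷ []) → Set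
  SumForm {U} {V} x = Σ (List (C U V)) (λ cs → x ≈T ∑ cs)

  SumForm-resp : ∀ {U V} {x y : T (U ∷ []) (V ∷ [])} → x ≈T y → SumForm y → SumForm x
  SumForm-resp e (cs , e') = cs , ≈trans e e'

  id-SumForm : ∀ (U : M) → SumForm (idT (U ∷ []))
  id-SumForm U = idC U ∷ [] , ≈sym (≈trans (⊞-unitʳ _) (⌈id⌉ U))

  𝟘-SumForm : ∀ {U V} → SumForm (𝟘 {U ∷ []} {V ∷ []})
  𝟘-SumForm = [] , ≈refl

  μ-at⨾π-at-SumForm : ∀ {P : Pl} {n m W W'} (a : At P n W) (b : At P m W') → SumForm (μ-at a ⨾ π-at b)
  μ-at⨾π-at-SumForm {U ∷ P} at0 at0 = SumForm-resp (≈trans (≈sym (interchange _ _ _ _)) (≈trans (⊕-cong (idˡ _) (¡⨾! P)) (⊕-unitʳ _))) (id-SumForm U)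
  μ-at⨾π-at-SumForm {U ∷ P} at0 (atS b) = SumForm-resp (≈trans (≈sym (interchange _ _ _ _)) (≈trans (⊕-cong (idˡ _) (¡-nat (π-at b))) (!⊕¡≈!⨾¡ _ _))) 𝟘-SumForm
  μ-at⨾π-at-SumForm {U ∷ P} (atS a) at0 = SumForm-resp (≈trans (≈sym (interchange _ _ _ _)) (≈trans (⊕-cong (idʳ _) (!-nat (μ-at a))) (¡⊕!≈!⨾¡ _ _))) 𝟘-SumForm
  μ-at⨾π-at-SumForm {U ∷ P} (atS a) (atS b) = SumForm-resp (≈trans (≈sym (interchange _ _ _ _)) (≈trans (⊕ˡ (¡⨾! (U ∷ []))) (⊕-unitˡ _))) (μ-at⨾π-at-SumForm a b)

  Δ⨾⊕!ʳ : ∀ {P Q} (x : T P Q) → (Δ P ⨾ (x ⊕ ! P)) ≈T x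
  Δ⨾⊕!ʳ {P} {Q} x = begin
    Δ P ⨾ (x ⊕ ! P) ≈⟨ ⨾ʳ (⊕-as-⨾′ x (! P)) ⟩
    Δ P ⨾ ((idT P ⊕ ! P) ⨾ (x ⊕ idT [])) ≈⟨ assocˡ ⟩
    (Δ P ⨾ (idT P ⊕ ! P)) ⨾ (x ⊕ idT []) ≈⟨ ⨾-cong (Δ-unitʳ P) (⊕-unitʳ x) ⟩
    idT P ⨾ x ≈⟨ idˡ x ⟩
    x ∎

  Δ⨾!⊕ˡ : ∀ {P Q} (x : T P Q) → (Δ P ⨾ (! P ⊕ x)) ≈T x
  Δ⨾!⊕ˡ {P} {Q} x = begin
    Δ P ⨾ (! P ⊕ x) ≈⟨ ⨾ʳ (⊕-as-⨾ (! P) x) ⟩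
    Δ P ⨾ ((! P ⊕ idT P) ⨾ (idT [] ⊕ x)) ≈⟨ assocˡ ⟩
    (Δ P ⨾ (! P ⊕ idT P)) ⨾ (idT [] ⊕ x) ≈⟨ ⨾-cong (Δ-unit P) (⊕-unitˡ x) ⟩
    idT P ⨾ x ≈⟨ idˡ x ⟩
    x ∎

  ⊕¡⨾∇ʳ : ∀ {P Q} (y : T P Q) → ((y ⊕ ¡ Q) ⨾ ∇ Q) ≈T y
  ⊕¡⨾∇ʳ {P} {Q} y = begin
    (y ⊕ ¡ Q) ⨾ ∇ Q ≈⟨ ⨾ˡ (⊕-as-⨾ y (¡ Q)) ⟩
    ((y ⊕ idT []) ⨾ (idT Q ⊕ ¡ Q)) ⨾ ∇ Q ≈⟨ ⨾-assoc _ _ _ ⟩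
    (y ⊕ idT []) ⨾ ((idT Q ⊕ ¡ Q) ⨾ ∇ Q) ≈⟨ ⨾-cong (⊕-unitʳ y) (∇-unitʳ Q) ⟩
    y ⨾ idT Q ≈⟨ idʳ y ⟩
    y ∎

  ¡⊕⨾∇ˡ : ∀ {P Q} (y : T P Q) → ((¡ Q ⊕ y) ⨾ ∇ Q) ≈T y
  ¡⊕⨾∇ˡ {P} {Q} y = begin
    (¡ Q ⊕ y) ⨾ ∇ Q ≈⟨ ⨾ˡ (⊕-as-⨾′ (¡ Q) y) ⟩
    ((idT [] ⊕ y) ⨾ (¡ Q ⊕ idT Q)) ⨾ ∇ Q ≈⟨ ⨾-assoc _ _ _ ⟩
    (idT [] ⊕ y) ⨾ ((¡ Q ⊕ idT Q) ⨾ ∇ Q) ≈⟨ ⨾-cong (⊕-unitˡ y) (∇-unit Q) ⟩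
    y ⨾ idT Q ≈⟨ idʳ y ⟩
    y ∎

  SumForm-absorbˡ : ∀ {P Q : Pl} {W W'} {x : T (W ∷ []) P} {t : T P Q} {y : T (W ∷ []) Q} (b : T Q (W' ∷ [])) →
                    (x ⨾ t) ≈T y → SumForm (y ⨾ b) → SumForm (x ⨾ t ⨾ b)
  SumForm-absorbˡ b e nf = SumForm-resp (≈trans assocˡ (⨾ˡ e)) nf

  SumForm-⨾ : ∀ {Q : Pl} {W W'} (x : T (W ∷ []) Q) (y : T Q (W' ∷ [])) →
              (∀ j → SumForm (x ⨾ π Q j)) → (∀ j → SumForm (μ Q j ⨾ y)) → SumForm (x ⨾ y)
  SumForm-⨾ {Q} {W} {W'} x y x⨾π y⨾μ = concat[] Q (λ j → products (cs j) (ds j)) , (begin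
    x ⨾ y ≈˘⟨ ⨾ʳ (idˡ y) ⟩
    x ⨾ (idT Q ⨾ y) ≈⟨ ⨾ʳ (⨾ˡ (id≈Σ⊞π⨾μ Q)) ⟩
    x ⨾ (Σ⊞ Q (λ j → π Q j ⨾ μ Q j) ⨾ y) ≈⟨ ⨾ʳ (⨾-distribʳ-Σ⊞ Q _ y) ⟩
    x ⨾ Σ⊞ Q (λ j → (π Q j ⨾ μ Q j) ⨾ y) ≈⟨ ⨾-distribˡ-Σ⊞ Q x _ ⟩
    Σ⊞ Q (λ j → x ⨾ ((π Q j ⨾ μ Q j) ⨾ y)) ≈⟨ Σ⊞-∑ Q _ _ entry ⟩
    ∑ (concat[] Q (λ j → products (cs j) (ds j))) ∎)
    where
    cs : (j : Fin (length Q)) → List (C W (lookup Q j))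
    cs j = proj₁ (x⨾π j)
    ds : (j : Fin (length Q)) → List (C (lookup Q j) W')
    ds j = proj₁ (y⨾μ j)
    entry : ∀ j → (x ⨾ ((π Q j ⨾ μ Q j) ⨾ y)) ≈T ∑ (products (cs j) (ds j))
    entry j = begin
      x ⨾ ((π Q j ⨾ μ Q j) ⨾ y) ≈⟨ ⨾ʳ (⨾-assoc _ _ _) ⟩
      x ⨾ (π Q j ⨾ (μ Q j ⨾ y)) ≈⟨ assocˡ ⟩
      (x ⨾ π Q j) ⨾ (μ Q j ⨾ y) ≈⟨ ⨾-cong (proj₂ (x⨾π j)) (proj₂ (y⨾μ j)) ⟩
      ∑ (cs j) ⨾ ∑ (ds j) ≈⟨ ∑⨾∑≈∑products (cs j) (ds j) ⟩
      ∑ (products (cs j) (ds j)) ∎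

  ⊕-entryˡˡ : ∀ {P Q P' Q'} (t : T P Q) (s : T P' Q') {n m W W'} (a : At P n W) (b : At Q m W') →
              (μ-at (at-++ˡ {Q = P'} a) ⨾ (t ⊕ s) ⨾ π-at (at-++ˡ {Q = Q'} b)) ≈T (μ-at a ⨾ t ⨾ π-at b)
  ⊕-entryˡˡ {P' = P'} t s a b =
    ≈trans (⨾-cong (μ-at-++ˡ a) (⨾ʳ (π-at-++ˡ b))) (≈trans (≈sym (⊕-interchange₃ _ _ _ _ _ _))
      (≈trans (⊕ʳ (≈trans (⨾ʳ (!-nat s)) (¡⨾! P'))) (⊕-unitʳ _)))

  ⊕-entryʳʳ : ∀ {P Q P' Q'} (t : T P Q) (s : T P' Q') {n m W W'} (a : At P' n W) (b : At Q' m W') →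
              (μ-at (at-++ʳ P a) ⨾ (t ⊕ s) ⨾ π-at (at-++ʳ Q b)) ≈T (μ-at a ⨾ s ⨾ π-at b)
  ⊕-entryʳʳ {P} {Q} t s a b =
    ≈trans (⨾-cong (μ-at-++ʳ P a) (⨾ʳ (π-at-++ʳ Q b))) (≈trans (≈sym (⊕-interchange₃ _ _ _ _ _ _))
      (≈trans (⊕ˡ (≈trans (⨾ʳ (!-nat t)) (¡⨾! P))) (⊕-unitˡ _)))

  ⊕-entryˡʳ : ∀ {P Q P' Q'} (t : T P Q) (s : T P' Q') {n m W W'} (a : At P n W) (b : At Q' m W') →
              (μ-at (at-++ˡ {Q = P'} a) ⨾ (t ⊕ s) ⨾ π-at (at-++ʳ Q b)) ≈T 𝟘 {W ∷ []} {W' ∷ []}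
  ⊕-entryˡʳ {Q = Q} t s a b =
    ≈trans (⨾-cong (μ-at-++ˡ a) (⨾ʳ (π-at-++ʳ Q b))) (≈trans (≈sym (⊕-interchange₃ _ _ _ _ _ _))
      (≈trans (⊕-cong (≈trans (⨾ʳ (!-nat t)) (!-nat (μ-at a))) (¡-nat _)) (!⊕¡≈!⨾¡ _ _)))

  ⊕-entryʳˡ : ∀ {P Q P' Q'} (t : T P Q) (s : T P' Q') {n m W W'} (a : At P' n W) (b : At Q m W') →
              (μ-at (at-++ʳ P a) ⨾ (t ⊕ s) ⨾ π-at (at-++ˡ {Q = Q'} b)) ≈T 𝟘 {W ∷ []} {W' ∷ []}
  ⊕-entryʳˡ {P} t s a b =
    ≈trans (⨾-cong (μ-at-++ʳ P a) (⨾ʳ (π-at-++ˡ b))) (≈trans (≈sym (⊕-interchange₃ _ _ _ _ _ _))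
      (≈trans (⊕-cong (¡-nat _) (≈trans (⨾ʳ (!-nat s)) (!-nat (μ-at a)))) (¡⊕!≈!⨾¡ _ _)))

  entry-SumForm : ∀ {P Q} (t : T P Q) {n m W W'} (a : At P n W) (b : At Q m W') → SumForm (μ-at a ⨾ t ⨾ π-at b)
  entry-SumForm ⌈ c ⌉ at0 at0 = c ∷ [] , ≈trans (⨾-cong μ≈id (⨾ʳ π≈id)) (≈trans (idˡ _) (≈trans (idʳ _) (≈sym (⊞-unitʳ _))))
    where
    μ≈id = ≈trans (⊕ʳ ¡-[]) (⊕-unitʳ (idT (_ ∷ [])))
    π≈id = ≈trans (⊕ʳ !-[]) (⊕-unitʳ (idT (_ ∷ [])))
  entry-SumForm (idT P) a b = SumForm-resp (⨾ʳ (idˡ _)) (μ-at⨾π-at-SumForm a b)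
  entry-SumForm (σ⊕ P Q) a b with at++-view P a
  ... | inˡ a' = SumForm-absorbˡ (π-at b) e (μ-at⨾π-at-SumForm (at-++ʳ Q a') b)
    where
    e = ≈trans (⨾ˡ (μ-at-++ˡ a')) (≈trans (σ-nat _ _) (≈trans (⨾ˡ (σ-unit _)) (≈trans (idˡ _) (≈sym (μ-at-++ʳ Q a')))))
  ... | inʳ a' = SumForm-absorbˡ (π-at b) e (μ-at⨾π-at-SumForm (at-++ˡ a') b)
    where
    e = ≈trans (⨾ˡ (μ-at-++ʳ P a')) (≈trans (σ-nat _ _) (≈trans (⨾ˡ (σ-[]ˡ _)) (≈trans (idˡ _) (≈sym (μ-at-++ˡ a')))))
  entry-SumForm (Δ P) a b with at++-view P b
  ... | inˡ b' = SumForm-resp (⨾ʳ (≈trans (⨾ʳ (π-at-++ˡ b')) (Δ⨾⊕!ʳ _))) (μ-at⨾π-at-SumForm a b')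
  ... | inʳ b' = SumForm-resp (⨾ʳ (≈trans (⨾ʳ (π-at-++ʳ P b')) (Δ⨾!⊕ˡ _))) (μ-at⨾π-at-SumForm a b')
  entry-SumForm (∇ P) a b with at++-view P a
  ... | inˡ a' = SumForm-absorbˡ (π-at b) (≈trans (⨾ˡ (μ-at-++ˡ a')) (⊕¡⨾∇ʳ _)) (μ-at⨾π-at-SumForm a' b)
  ... | inʳ a' = SumForm-absorbˡ (π-at b) (≈trans (⨾ˡ (μ-at-++ʳ P a')) (¡⊕⨾∇ˡ _)) (μ-at⨾π-at-SumForm a' b)
  entry-SumForm (_⨾_ {Q = Q} t s) a c =
    SumForm-resp (≈trans (⨾ʳ (⨾-assoc _ _ _)) assocˡ) (SumForm-⨾ (μ-at a ⨾ t) (s ⨾ π-at c) x⨾π y⨾μ)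
    where
    x⨾π : ∀ j → SumForm ((μ-at a ⨾ t) ⨾ π Q j)
    x⨾π j = SumForm-resp (⨾-assoc _ _ _)
              (subst (λ p → SumForm (μ-at a ⨾ t ⨾ p)) (sym (π≡π-at Q j)) (entry-SumForm t a (at-lookup j)))
    y⨾μ : ∀ j → SumForm (μ Q j ⨾ s ⨾ π-at c)
    y⨾μ j = subst (λ m → SumForm (m ⨾ s ⨾ π-at c)) (sym (μ≡μ-at Q j)) (entry-SumForm s (at-lookup j) c)
  entry-SumForm (_⊕_ {P} {Q} t s) a b with at++-view P a | at++-view Q b
  ... | inˡ a' | inˡ b' = SumForm-resp (⊕-entryˡˡ t s a' b') (entry-SumForm t a' b')
  ... | inˡ a' | inʳ b' = SumForm-resp (⊕-entryˡʳ t s a' b') 𝟘-SumForm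
  ... | inʳ a' | inˡ b' = SumForm-resp (⊕-entryʳˡ t s a' b') 𝟘-SumForm
  ... | inʳ a' | inʳ b' = SumForm-resp (⊕-entryʳʳ t s a' b') (entry-SumForm s a' b')

  μ⨾t⨾π-SumForm : ∀ {P Q} (t : T P Q) (i : Fin (length P)) (j : Fin (length Q)) → SumForm (μ P i ⨾ t ⨾ π Q j)
  μ⨾t⨾π-SumForm {P} {Q} t i j =
    subst₂ (λ m p → SumForm (m ⨾ t ⨾ p)) (sym (μ≡μ-at P i)) (sym (π≡π-at Q j)) (entry-SumForm t (at-lookup i) (at-lookup j))

-- A positional semantics of tapes

module Denotation {𝒮 : Signature} (𝕀 : Theory 𝒮) where
  private
    M : Set
    M = Mono 𝒮
    Pl : Set
    Pl = Poly 𝒮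
    C : M → M → Set
    C = Circ 𝒮
    T : Pl → Pl → Set
    T = Tape 𝒮
    -- The signature cannot be inferred from a polynomial, which is only a list of lists of sorts.
    infixr 7 _⊗′_
    _⊗′_ : Pl → Pl → Pl
    _⊗′_ = _⊗P_ {𝒮}
    _⊠′_ : M → Pl → Pl
    _⊠′_ = _⊠_ {𝒮}

  infix 4 _≤C_
  _≤C_ : ∀ {u v} → C u v → C u v → Set
  c ≤C d = LeC 𝕀 c d

  ≤refl : ∀ {u v} {c : C u v} → c ≤C c
  ≤refl = ≈⇒≤ ≈refl
  infixr 2 _⟫_
  _⟫_ : ∀ {u v} {c d e : C u v} → c ≤C d → d ≤C e → c ≤C e
  _⟫_ = ≤trans
  id⨾id≤id : ∀ {u} → (idC u ⨾C idC u) ≤C idC {𝒮} u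
  id⨾id≤id {u} = ≈⇒≤ (idˡ (idC u))
  ≤⨾-dropʳ : ∀ {u v} {c : C u v} {c₁ : C u v} {c₂ : C v v} → c ≤C (c₁ ⨾C c₂) → c₂ ≤C idC v → c ≤C c₁
  ≤⨾-dropʳ le l2 = le ⟫ ⨾-mono ≤refl l2 ⟫ ≈⇒≤ (idʳ _)
  ≤⨾-dropˡ : ∀ {u w} {c : C u w} {c₁ : C u u} {c₂ : C u w} → c ≤C (c₁ ⨾C c₂) → c₁ ≤C idC u → c ≤C c₂
  ≤⨾-dropˡ le l1 = le ⟫ ⨾-mono l1 ≤refl ⟫ ≈⇒≤ (idˡ _)
  ≤-padˡ : ∀ {u v} {c c' : C u v} → c ≤C c' → c ≤C (idC u ⨾C c')
  ≤-padˡ le = le ⟫ ≈⇒≤ (≈sym (idˡ _))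
  ≤-padʳ : ∀ {u v} {c c' : C u v} → c ≤C c' → c ≤C (c' ⨾C idC v)
  ≤-padʳ le = le ⟫ ≈⇒≤ (≈sym (idʳ _))
  ≤⨾-id : ∀ {u} {c : C u u} {c₁ c₂ : C u u} → c ≤C (c₁ ⨾C c₂) → c₁ ≤C idC u → c₂ ≤C idC u → c ≤C idC u
  ≤⨾-id le l1 l2 = le ⟫ ⨾-mono l1 l2 ⟫ id⨾id≤id

  PosRel : Set₁
  PosRel = ℕ → ℕ → Set

  idR : PosRel
  idR i j = j ≡ i

  swapR : ℕ → ℕ → PosRel
  swapR n m i j = ((i < n) × (j ≡ m + i)) ⊎ (i ≡ n + j)

  copyR : ℕ → PosRel
  copyR n i j = (j ≡ i) ⊎ (j ≡ n + i)

  mergeR : ℕ → PosRel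
  mergeR n i j = ((i < n) × (j ≡ i)) ⊎ (i ≡ n + j)

  sumR : ℕ → ℕ → PosRel → PosRel → PosRel
  sumR n m R R' i j = ((i < n) × R i j) ⊎ Σ ℕ (λ i' → Σ ℕ (λ j' → (i ≡ n + i') × (j ≡ m + j') × R' i' j'))

  compR : PosRel → PosRel → PosRel
  compR R R' i k = Σ ℕ (λ j → R i j × R' j k)

  emptyR : PosRel
  emptyR _ _ = ⊥

  -- D t i j c means that c lies ≤𝕀-below a summand of the (i, j) entry of t.  Positions
  -- are natural numbers rather than Fin, so that ⊕ shifts them by length P and the
  -- propositional associativity of _++_ costs no transport.
  Den : Set₁
  Den = ℕ → ℕ → ∀ {X Y : M} → C X Y → Set

  data Below {u v : M} (c : C u v) : ℕ → ℕ → ∀ {X Y : M} → C X Y → Set where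
    below : ∀ {c' : C u v} → c' ≤C c → Below c 0 0 c'

  data Wires (P : Pl) (R : PosRel) : ℕ → ℕ → ∀ {X Y : M} → C X Y → Set where
    wire : ∀ {i j W} {c : C W W} → At P i W → R i j → c ≤C idC W → Wires P R i j c

  Empty : Den
  Empty _ _ _ = ⊥

  data Seq (A B : Den) : ℕ → ℕ → ∀ {X Y : M} → C X Y → Set where
    seq : ∀ {i j k X Y Z} {c₁ : C X Y} {c₂ : C Y Z} {c : C X Z} →
         A i j c₁ → B j k c₂ → c ≤C (c₁ ⨾C c₂) → Seq A B i k c

  data Sum (n m : ℕ) (A B : Den) : ℕ → ℕ → ∀ {X Y : M} → C X Y → Set where
    -- no bound i < n: well-typed denotations (D-typed) never use positions beyond n
    left : ∀ {i j X Y} {c : C X Y} → A i j c → Sum n m A B i j c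
    right : ∀ {i j i' j' X Y} {c : C X Y} → i ≡ n + i' → j ≡ m + j' → B i' j' c → Sum n m A B i j c

  D : ∀ {P Q} → Tape 𝒮 P Q → Den
  D ⌈ c ⌉ = Below c
  D (idT P) = Wires P idR
  D (σ⊕ P Q) = Wires (P ++ Q) (swapR (length P) (length Q))
  D (Δ P) = Wires P (copyR (length P))
  D (! P) = Empty
  D (∇ P) = Wires (P ++ P) (mergeR (length P))
  D (¡ P) = Empty
  D (t ⨾ s) = Seq (D t) (D s)
  D (_⊕_ {P} {Q} t s) = Sum (length P) (length Q) (D t) (D s)

  infix 4 _⊆_ _≅_
  _⊆_ : Den → Den → Set
  A ⊆ B = ∀ {i j X Y} {c : C X Y} → A i j c → B i j c

  _≅_ : Den → Den → Set
  A ≅ B = (A ⊆ B) × (B ⊆ A)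

  ≅refl : ∀ {A} → A ≅ A
  ≅refl = (λ x → x) , (λ x → x)
  ≅sym : ∀ {A B} → A ≅ B → B ≅ A
  ≅sym (f , g) = g , f
  ≅trans : ∀ {A B E} → A ≅ B → B ≅ E → A ≅ E
  ≅trans (f , g) (f' , g') = (λ x → f' (f x)) , (λ x → g (g' x))

  Seq-mono : ∀ {A A' B B'} → A ⊆ A' → B ⊆ B' → Seq A B ⊆ Seq A' B'
  Seq-mono f g (seq a b le) = seq (f a) (g b) le
  Seq-cong : ∀ {A A' B B'} → A ≅ A' → B ≅ B' → Seq A B ≅ Seq A' B'
  Seq-cong (f , f') (g , g') = Seq-mono f g , Seq-mono f' g'
  Sum-mono : ∀ {n m A A' B B'} → A ⊆ A' → B ⊆ B' → Sum n m A B ⊆ Sum n m A' B'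
  Sum-mono f g (left a) = left (f a)
  Sum-mono f g (right e e' b) = right e e' (g b)
  Sum-cong : ∀ {n m A A' B B'} → A ≅ A' → B ≅ B' → Sum n m A B ≅ Sum n m A' B'
  Sum-cong (f , f') (g , g') = Sum-mono f g , Sum-mono f' g'

  WellTyped : Pl → Pl → Den → Set
  WellTyped P Q A = ∀ {i j X Y} {c : C X Y} → A i j c → At P i X × At Q j Y

  DownClosed : Den → Set
  DownClosed A = ∀ {i j X Y} {c c' : C X Y} → c' ≤C c → A i j c → A i j c'

  Respects : Pl → Pl → PosRel → Set
  Respects P Q R = ∀ {i j W} → At P i W → R i j → At Q j W

  respects-id : ∀ {P} → Respects P P idR
  respects-id a refl = a

  respects-swap : ∀ {P Q} → Respects (P ++ Q) (Q ++ P) (swapR (length P) (length Q))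
  respects-swap {P} {Q} a (inj₁ (lt , refl)) = at-++ʳ Q (at-++ˡ⁻ P a lt)
  respects-swap {P} {Q} a (inj₂ refl) = at-++ˡ (at-++ʳ⁻ P a)

  respects-copy : ∀ {P} → Respects P (P ++ P) (copyR (length P))
  respects-copy a (inj₁ refl) = at-++ˡ a
  respects-copy {P} a (inj₂ refl) = at-++ʳ P a

  respects-merge : ∀ {P} → Respects (P ++ P) P (mergeR (length P))
  respects-merge {P} a (inj₁ (lt , refl)) = at-++ˡ⁻ P a lt
  respects-merge {P} a (inj₂ refl) = at-++ʳ⁻ P a

  Wires-typed : ∀ {P Q R} → Respects P Q R → WellTyped P Q (Wires P R)
  Wires-typed rp (wire a r x) = a , rp a r

  D-typed : ∀ {P Q} (t : Tape 𝒮 P Q) → WellTyped P Q (D t)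
  D-typed ⌈ c ⌉ (below x) = at0 , at0
  D-typed (idT P) = Wires-typed respects-id
  D-typed (σ⊕ P Q) = Wires-typed (respects-swap {P} {Q})
  D-typed (Δ P) = Wires-typed (respects-copy {P})
  D-typed (! P) ()
  D-typed (∇ P) = Wires-typed (respects-merge {P})
  D-typed (¡ P) ()
  D-typed (t ⨾ s) (seq a b x) = proj₁ (D-typed t a) , proj₂ (D-typed s b)
  D-typed (_⊕_ {P} {Q} t s) (left a) = at-++ˡ (proj₁ (D-typed t a)) , at-++ˡ (proj₂ (D-typed t a))
  D-typed (_⊕_ {P} {Q} t s) (right refl refl a) = at-++ʳ P (proj₁ (D-typed s a)) , at-++ʳ Q (proj₂ (D-typed s a))

  Wires-down : ∀ {P R} → DownClosed (Wires P R)
  Wires-down le (wire a r x) = wire a r (le ⟫ x)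

  D-down : ∀ {P Q} (t : Tape 𝒮 P Q) → DownClosed (D t)
  D-down ⌈ c ⌉ le (below x) = below (le ⟫ x)
  D-down (idT P) = Wires-down
  D-down (σ⊕ P Q) = Wires-down
  D-down (Δ P) = Wires-down
  D-down (! P) le ()
  D-down (∇ P) = Wires-down
  D-down (¡ P) le ()
  D-down (t ⨾ s) le (seq a b x) = seq a b (le ⟫ x)
  D-down (t ⊕ s) le (left a) = left (D-down t le a)
  D-down (t ⊕ s) le (right e f a) = right e f (D-down s le a)

  -- The laws of T_Σ hold in the semantics

  sem-idˡ : ∀ {P Q A} → WellTyped P Q A → DownClosed A → Seq (Wires P idR) A ≅ A
  sem-idˡ ty dn = (λ { (seq (wire a refl l1) x le) → dn (≤⨾-dropˡ le l1) x })
              , (λ x → seq (wire (proj₁ (ty x)) refl ≤refl) x (≤-padˡ ≤refl))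

  sem-idʳ : ∀ {P Q A} → WellTyped P Q A → DownClosed A → Seq A (Wires Q idR) ≅ A
  sem-idʳ ty dn = (λ { (seq x (wire a refl l2) le) → dn (≤⨾-dropʳ le l2) x })
              , (λ x → seq x (wire (proj₂ (ty x)) refl ≤refl) (≤-padʳ ≤refl))

  sem-⨾-assoc : ∀ {A B E} → Seq (Seq A B) E ≅ Seq A (Seq B E)
  sem-⨾-assoc = (λ { (seq (seq a b l1) e l2) → seq a (seq b e ≤refl) (l2 ⟫ ⨾-mono l1 ≤refl ⟫ ≈⇒≤ (⨾-assoc _ _ _)) })
          , (λ { (seq a (seq b e l1) l2) → seq (seq a b ≤refl) e (l2 ⟫ ⨾-mono ≤refl l1 ⟫ ≈⇒≤ (≈sym (⨾-assoc _ _ _))) })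

  sem-⊕-assoc-ℕ : ∀ n₁ n₂ m₁ m₂ {A B E} → Sum (n₁ + n₂) (m₁ + m₂) (Sum n₁ m₁ A B) E ≅ Sum n₁ m₁ A (Sum n₂ m₂ B E)
  sem-⊕-assoc-ℕ n₁ n₂ m₁ m₂ =
      (λ { (left (left a)) → left a ; (left (right e f b)) → right e f (left b)
         ; (right refl refl x) → right (+-assoc n₁ n₂ _) (+-assoc m₁ m₂ _) (right refl refl x) })
    , (λ { (left a) → left (left a) ; (right e f (left b)) → left (right e f b)
         ; (right refl refl (right refl refl x)) → right (sym (+-assoc n₁ n₂ _)) (sym (+-assoc m₁ m₂ _)) x })

  sem-⊕-unitˡ : ∀ {A} → Sum 0 0 (Wires [] idR) A ≅ A
  sem-⊕-unitˡ = (λ { (left (wire () _ _)) ; (right refl refl x) → x }) , (λ x → right refl refl x)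

  sem-⊕-unitʳ : ∀ {n m A} → Sum n m A (Wires [] idR) ≅ A
  sem-⊕-unitʳ = (λ { (left x) → x ; (right _ _ (wire () _ _)) }) , left

  Wires-seq : ∀ {P Q R R'} → Respects P Q R → Seq (Wires P R) (Wires Q R') ≅ Wires P (compR R R')
  Wires-seq rp = (λ { (seq (wire a r l1) (wire a' r' l2) le) → wire a (_ , r , r') (≤⨾-id le l1 l2) })
             , (λ { (wire a (j , r , r') le) → seq (wire a r ≤refl) (wire (rp a r) r' ≤refl) (le ⟫ ≈⇒≤ (≈sym (idˡ _))) })

  Wires-sum : ∀ {P P' R R' m} → Sum (length P) m (Wires P R) (Wires P' R') ≅ Wires (P ++ P') (sumR (length P) m R R')
  Wires-sum {P} = (λ { (left (wire a r le)) → wire (at-++ˡ a) (inj₁ (at-<length a , r)) le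
                   ; (right refl f (wire a r le)) → wire (at-++ʳ P a) (inj₂ (_ , _ , refl , f , r)) le })
              , (λ { (wire a (inj₁ (lt , r)) le) → left (wire (at-++ˡ⁻ P a lt) r le)
                   ; (wire a (inj₂ (i' , j' , refl , f , r)) le) → right refl f (wire (at-++ʳ⁻ P a) r le) })

  Wires-rel : ∀ {P R R'} → (∀ {i j W} → At P i W → R i j → R' i j) → Wires P R ⊆ Wires P R'
  Wires-rel h (wire a r le) = wire a (h a r) le

  Wires-releq : ∀ {P R R'} → (∀ {i j W} → At P i W → R i j → R' i j) → (∀ {i j W} → At P i W → R' i j → R i j) → Wires P R ≅ Wires P R'
  Wires-releq h h' = Wires-rel h , Wires-rel h'

  Empty≅Wires : ∀ {P} → Empty ≅ Wires P emptyR
  Empty≅Wires = (λ ()) , (λ { (wire _ () _) })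

  respects-sum : ∀ {P P' Q Q' R R'} → Respects P Q R → Respects P' Q' R' → Respects (P ++ P') (Q ++ Q') (sumR (length P) (length Q) R R')
  respects-sum {P} rp rp' a (inj₁ (lt , r)) = at-++ˡ (rp (at-++ˡ⁻ P a lt) r)
  respects-sum {P} {Q = Q} rp rp' a (inj₂ (i' , j' , refl , refl , r)) = at-++ʳ Q (rp' (at-++ʳ⁻ P a) r)

  respects-empty : ∀ {P Q} → Respects P Q emptyR
  respects-empty _ ()

  Wires-list : ∀ {P P' R} → P ≡ P' → Wires P R ≅ Wires P' R
  Wires-list refl = ≅refl

  swap-swap≅id : ∀ (P Q : Pl) → Wires (P ++ Q) (compR (swapR (length P) (length Q)) (swapR (length Q) (length P))) ≅ Wires (P ++ Q) idR
  swap-swap≅id P Q = Wires-releq h1 h2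
    where
    p = length P
    q = length Q
    h1 : ∀ {i k W} → At (P ++ Q) i W → compR (swapR p q) (swapR q p) i k → idR i k
    h1 a (j , inj₁ (lt , refl) , inj₁ (lt' , _)) = ⊥-elim (m+n≮m q _ lt')
    h1 a (j , inj₁ (lt , refl) , inj₂ e) = sym (+-cancelˡ-≡ q _ _ e)
    h1 a (j , inj₂ refl , inj₁ (lt' , refl)) = refl
    h1 {i} a (j , inj₂ refl , inj₂ refl) = ⊥-elim (m+n≮m q _ (+-cancelˡ-< p _ _ (at-<length-++ P Q a)))
    h2 : ∀ {i k W} → At (P ++ Q) i W → idR i k → compR (swapR p q) (swapR q p) i k
    h2 {i} a refl with <⊎≡+ p i
    ... | inj₁ lt = q + i , inj₁ (lt , refl) , inj₂ refl
    ... | inj₂ (j , refl) = j , inj₂ refl , inj₁ (+-cancelˡ-< p _ _ (at-<length-++ P Q a) , refl)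

  sem-σ-inv : ∀ (P Q : Pl) → Seq (Wires (P ++ Q) (swapR (length P) (length Q))) (Wires (Q ++ P) (swapR (length Q) (length P))) ≅ Wires (P ++ Q) idR
  sem-σ-inv P Q = ≅trans (Wires-seq (respects-swap {P} {Q})) (swap-swap≅id P Q)

  sem-σ-unit : ∀ (P : Pl) → Wires (P ++ []) (swapR (length P) 0) ≅ Wires P idR
  sem-σ-unit P = ≅trans (Wires-list (++-identityʳ P)) (Wires-releq h1 h2)
    where
    h1 : ∀ {i k W} → At P i W → swapR (length P) 0 i k → idR i k
    h1 a (inj₁ (_ , e)) = e
    h1 a (inj₂ refl) = ⊥-elim (at-beyond P a)
    h2 : ∀ {i k W} → At P i W → idR i k → swapR (length P) 0 i k
    h2 a refl = inj₁ (at-<length a , refl)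

  swap-hexagon : ∀ (P : Pl) (U : M) (R : Pl) →
    Wires (P ++ U ∷ R) (swapR (length P) (suc (length R))) ≅
    Wires (P ++ U ∷ R) (compR (sumR (length (P ++ U ∷ [])) (suc (length P)) (swapR (length P) 1) idR) (sumR 1 1 idR (swapR (length P) (length R))))
  swap-hexagon P U R = Wires-releq h1 h2
    where
    p = length P
    r = length R
    pu = length (P ++ U ∷ [])
    epu : pu ≡ p + 1
    epu = length-++ P
    lt-pu : ∀ {i} → i < p → i < pu
    lt-pu lt = subst (_ <_) (sym epu) (<⇒<+ 1 lt)
    h1 : ∀ {i k W} → At (P ++ U ∷ R) i W → swapR p (suc r) i k →
         compR (sumR pu (suc p) (swapR p 1) idR) (sumR 1 1 idR (swapR p r)) i k
    h1 {i} a (inj₁ (lt , refl)) = suc i , inj₁ (lt-pu lt , inj₁ (lt , refl)) , inj₂ (i , r + i , refl , refl , inj₁ (lt , refl))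
    h1 {k = zero} a (inj₂ refl) = 0 , inj₁ (lt-pu' , inj₂ refl) , inj₁ (s≤s z≤n , refl)
      where
      lt-pu' : p + 0 < pu
      lt-pu' = subst₂ _<_ (sym (+-identityʳ p)) (sym epu) (m<m+n p (s≤s z≤n))
    h1 {k = suc k} a (inj₂ refl) = suc (p + k) , inj₂ (k , k , e , refl , refl) , inj₂ (p + k , k , refl , refl , inj₂ refl)
      where
      e : p + suc k ≡ pu + k
      e = trans (+-suc p k) (trans (cong (_+ k) (trans (+-comm 1 p) (sym epu))) refl)
    h2 : ∀ {i k W} → At (P ++ U ∷ R) i W →
         compR (sumR pu (suc p) (swapR p 1) idR) (sumR 1 1 idR (swapR p r)) i k → swapR p (suc r) i k
    h2 a (j , inj₁ (_ , inj₁ (lt , refl)) , inj₁ (s≤s () , _))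
    h2 a (j , inj₁ (_ , inj₁ (lt , refl)) , inj₂ (i' , j' , refl , refl , inj₁ (lt' , refl))) = inj₁ (lt , refl)
    h2 a (j , inj₁ (_ , inj₁ (lt , refl)) , inj₂ (i' , j' , refl , refl , inj₂ refl)) = ⊥-elim (m+n≮m p _ lt)
    h2 a (zero , inj₁ (_ , inj₂ refl) , inj₁ (_ , refl)) = inj₂ refl
    h2 a (zero , inj₁ (_ , inj₂ refl) , inj₂ (i' , j' , () , _ , _))
    h2 a (suc j , inj₁ (lt , inj₂ refl) , _) with +-cancelˡ-< p _ _ (subst (_ <_) epu lt)
    ... | s≤s ()
    h2 a (j , inj₂ (i' , j' , refl , refl , refl) , inj₁ (s≤s () , _))
    h2 a (j , inj₂ (i' , j' , refl , refl , refl) , inj₂ (.(p + i') , j'' , refl , refl , inj₁ (lt , _))) = ⊥-elim (m+n≮m p i' lt)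
    h2 a (j , inj₂ (i' , j' , refl , refl , refl) , inj₂ (.(p + i') , j'' , refl , refl , inj₂ e)) =
      inj₂ (trans (cong (_+ i') epu) (trans (+-assoc p 1 i') (cong (λ x → p + suc x) (+-cancelˡ-≡ p _ _ e))))

  sem-σ-hex : ∀ (P : Pl) (U : M) (R : Pl) →
    Wires (P ++ U ∷ R) (swapR (length P) (suc (length R))) ≅
    Seq (Sum (length (P ++ U ∷ [])) (length (U ∷ [] ++ P)) (Wires (P ++ U ∷ []) (swapR (length P) 1)) (Wires R idR))
         (Sum 1 1 (Wires (U ∷ []) idR) (Wires (P ++ R) (swapR (length P) (length R))))
  sem-σ-hex P U R = ≅trans (swap-hexagon P U R)
    (≅sym (≅trans (Seq-cong (Wires-sum {P ++ U ∷ []}) (Wires-sum {U ∷ []}))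
          (≅trans (Wires-seq (respects-sum (respects-swap {P} {U ∷ []}) (respects-id {R}))) (Wires-list (++-assoc P (U ∷ []) R)))))

  Wires-[] : ∀ {R R'} → Wires [] R ≅ Wires [] R'
  Wires-[] = (λ { (wire () _ _) }) , (λ { (wire () _ _) })

  Empty≅Wires-[] : ∀ {R} → Empty ≅ Wires [] R
  Empty≅Wires-[] = (λ ()) , (λ { (wire () _ _) })

  Empty≅Sum : ∀ {n m} → Empty ≅ Sum n m Empty Empty
  Empty≅Sum = (λ ()) , (λ { (left ()) ; (right _ _ ()) })

  Seq-Emptyˡ : ∀ {A} → Seq Empty A ≅ Empty
  Seq-Emptyˡ = (λ { (seq () _ _) }) , (λ ())

  Seq-Emptyʳ : ∀ {A} → Seq A Empty ≅ Empty
  Seq-Emptyʳ = (λ { (seq _ () _) }) , (λ ())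

  sem-∇-comm : ∀ (P : Pl) → Seq (Wires (P ++ P) (swapR (length P) (length P))) (Wires (P ++ P) (mergeR (length P))) ≅ Wires (P ++ P) (mergeR (length P))
  sem-∇-comm P = ≅trans (Wires-seq (respects-swap {P} {P})) (Wires-releq h1 h2)
    where
    p = length P
    h1 : ∀ {i k W} → At (P ++ P) i W → compR (swapR p p) (mergeR p) i k → mergeR p i k
    h1 a (j , inj₁ (lt , refl) , inj₁ (lt' , _)) = ⊥-elim (m+n≮m p _ lt')
    h1 a (j , inj₁ (lt , refl) , inj₂ e) = inj₁ (lt , sym (+-cancelˡ-≡ p _ _ e))
    h1 a (j , inj₂ refl , inj₁ (lt' , refl)) = inj₂ refl
    h1 a (j , inj₂ refl , inj₂ refl) = ⊥-elim (m+n≮m p _ (+-cancelˡ-< p _ _ (at-<length-++ P P a)))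
    h2 : ∀ {i k W} → At (P ++ P) i W → mergeR p i k → compR (swapR p p) (mergeR p) i k
    h2 {i} a (inj₁ (lt , refl)) = p + i , inj₁ (lt , refl) , inj₂ refl
    h2 {i} {k} a (inj₂ refl) = k , inj₂ refl , inj₁ (+-cancelˡ-< p _ _ (at-<length-++ P P a) , refl)

  sem-Δ-comm : ∀ (P : Pl) → Seq (Wires P (copyR (length P))) (Wires (P ++ P) (swapR (length P) (length P))) ≅ Wires P (copyR (length P))
  sem-Δ-comm P = ≅trans (Wires-seq (respects-copy {P})) (Wires-releq h1 h2)
    where
    p = length P
    h1 : ∀ {i k W} → At P i W → compR (copyR p) (swapR p p) i k → copyR p i k
    h1 a (j , inj₁ refl , inj₁ (lt , refl)) = inj₂ refl
    h1 a (j , inj₁ refl , inj₂ refl) = ⊥-elim (at-beyond P a)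
    h1 a (j , inj₂ refl , inj₁ (lt , _)) = ⊥-elim (m+n≮m p _ lt)
    h1 a (j , inj₂ refl , inj₂ e) = inj₁ (sym (+-cancelˡ-≡ p _ _ e))
    h2 : ∀ {i k W} → At P i W → copyR p i k → compR (copyR p) (swapR p p) i k
    h2 {i} a (inj₁ refl) = p + i , inj₂ refl , inj₂ refl
    h2 {i} a (inj₂ refl) = i , inj₁ refl , inj₁ (at-<length a , refl)

  sem-∇-unit : ∀ (P : Pl) → Seq (Sum 0 (length P) Empty (Wires P idR)) (Wires (P ++ P) (mergeR (length P))) ≅ Wires P idR
  sem-∇-unit P = ≅trans (Seq-cong (≅trans (Sum-cong (Empty≅Wires {[]}) ≅refl) (Wires-sum {[]})) ≅refl)
              (≅trans (Wires-seq (respects-sum {[]} {P} {P} {P} (respects-empty {[]} {P}) (respects-id {P}))) (Wires-releq h1 h2))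
    where
    p = length P
    h1 : ∀ {i k W} → At P i W → compR (sumR 0 p emptyR idR) (mergeR p) i k → idR i k
    h1 a (j , inj₁ (_ , ()) , _)
    h1 a (j , inj₂ (i' , j' , refl , refl , refl) , inj₁ (lt , _)) = ⊥-elim (m+n≮m p _ lt)
    h1 a (j , inj₂ (i' , j' , refl , refl , refl) , inj₂ e) = sym (+-cancelˡ-≡ p _ _ e)
    h2 : ∀ {i k W} → At P i W → idR i k → compR (sumR 0 p emptyR idR) (mergeR p) i k
    h2 {i} a refl = p + i , inj₂ (i , i , refl , refl , refl) , inj₂ refl

  sem-Δ-unit : ∀ (P : Pl) → Seq (Wires P (copyR (length P))) (Sum (length P) 0 Empty (Wires P idR)) ≅ Wires P idR
  sem-Δ-unit P = ≅trans (Seq-cong ≅refl (≅trans (Sum-cong (Empty≅Wires {P}) ≅refl) (Wires-sum {P})))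
              (≅trans (Wires-seq (respects-copy {P})) (Wires-releq h1 h2))
    where
    p = length P
    h1 : ∀ {i k W} → At P i W → compR (copyR p) (sumR p 0 emptyR idR) i k → idR i k
    h1 a (j , _ , inj₁ (_ , ()))
    h1 a (j , inj₁ refl , inj₂ (i' , j' , refl , refl , refl)) = ⊥-elim (at-beyond P a)
    h1 a (j , inj₂ refl , inj₂ (i' , j' , e , refl , refl)) = sym (+-cancelˡ-≡ p _ _ e)
    h2 : ∀ {i k W} → At P i W → idR i k → compR (copyR p) (sumR p 0 emptyR idR) i k
    h2 {i} a refl = p + i , inj₂ refl , inj₂ (i , i , refl , refl , refl)

  copy³R : ℕ → PosRel
  copy³R p i k = (k ≡ i) ⊎ (k ≡ p + i) ⊎ (k ≡ p + (p + i))

  sem-Δ-assoc : ∀ (P : Pl) →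
    Seq (Wires P (copyR (length P))) (Sum (length P) (length (P ++ P)) (Wires P (copyR (length P))) (Wires P idR)) ≅
    Seq (Wires P (copyR (length P))) (Sum (length P) (length P) (Wires P idR) (Wires P (copyR (length P))))
  sem-Δ-assoc P = ≅trans (Seq-cong ≅refl (Wires-sum {P})) (≅trans (Wires-seq (respects-copy {P})) (≅trans (Wires-releq h1 h2)
               (≅sym (≅trans (Seq-cong ≅refl (Wires-sum {P})) (≅trans (Wires-seq (respects-copy {P})) (Wires-releq g1 g2))))))
    where
    p = length P
    pp = length (P ++ P)
    epp : pp ≡ p + p
    epp = length-++ P
    h1 : ∀ {i k W} → At P i W → compR (copyR p) (sumR p pp (copyR p) idR) i k → copy³R p i k
    h1 a (j , inj₁ refl , inj₁ (_ , inj₁ e)) = inj₁ e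
    h1 a (j , inj₁ refl , inj₁ (_ , inj₂ e)) = inj₂ (inj₁ e)
    h1 a (j , inj₁ refl , inj₂ (i' , j' , refl , refl , refl)) = ⊥-elim (at-beyond P a)
    h1 a (j , inj₂ refl , inj₁ (lt , _)) = ⊥-elim (m+n≮m p _ lt)
    h1 a (j , inj₂ refl , inj₂ (i' , j' , e , refl , refl)) with +-cancelˡ-≡ p _ _ e
    ... | refl = inj₂ (inj₂ (trans (cong (_+ i') epp) (+-assoc p p i')))
    h2 : ∀ {i k W} → At P i W → copy³R p i k → compR (copyR p) (sumR p pp (copyR p) idR) i k
    h2 {i} a (inj₁ refl) = i , inj₁ refl , inj₁ (at-<length a , inj₁ refl)
    h2 {i} a (inj₂ (inj₁ refl)) = i , inj₁ refl , inj₁ (at-<length a , inj₂ refl)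
    h2 {i} a (inj₂ (inj₂ refl)) = p + i , inj₂ refl , inj₂ (i , i , refl , sym (trans (cong (_+ i) epp) (+-assoc p p i)) , refl)
    g1 : ∀ {i k W} → At P i W → compR (copyR p) (sumR p p idR (copyR p)) i k → copy³R p i k
    g1 a (j , inj₁ refl , inj₁ (_ , e)) = inj₁ e
    g1 a (j , inj₁ refl , inj₂ (i' , j' , refl , refl , _)) = ⊥-elim (at-beyond P a)
    g1 a (j , inj₂ refl , inj₁ (lt , _)) = ⊥-elim (m+n≮m p _ lt)
    g1 a (j , inj₂ refl , inj₂ (i' , j' , e , refl , inj₁ refl)) with +-cancelˡ-≡ p _ _ e
    ... | refl = inj₂ (inj₁ refl)
    g1 a (j , inj₂ refl , inj₂ (i' , j' , e , refl , inj₂ refl)) with +-cancelˡ-≡ p _ _ e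
    ... | refl = inj₂ (inj₂ refl)
    g2 : ∀ {i k W} → At P i W → copy³R p i k → compR (copyR p) (sumR p p idR (copyR p)) i k
    g2 {i} a (inj₁ refl) = i , inj₁ refl , inj₁ (at-<length a , refl)
    g2 {i} a (inj₂ (inj₁ refl)) = p + i , inj₂ refl , inj₂ (i , i , refl , refl , inj₁ refl)
    g2 {i} a (inj₂ (inj₂ refl)) = p + i , inj₂ refl , inj₂ (i , p + i , refl , refl , inj₂ refl)

  merge³R : ℕ → PosRel
  merge³R p i k = (k < p) × ((i ≡ k) ⊎ (i ≡ p + k) ⊎ (i ≡ p + (p + k)))

  sem-∇-assoc : ∀ (P : Pl) →
    Seq (Sum (length (P ++ P)) (length P) (Wires (P ++ P) (mergeR (length P))) (Wires P idR)) (Wires (P ++ P) (mergeR (length P))) ≅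
    Seq (Sum (length P) (length P) (Wires P idR) (Wires (P ++ P) (mergeR (length P)))) (Wires (P ++ P) (mergeR (length P)))
  sem-∇-assoc P = ≅trans (Seq-cong (Wires-sum {P ++ P}) ≅refl) (≅trans (Wires-seq (respects-sum (respects-merge {P}) (respects-id {P})))
               (≅trans (Wires-list (++-assoc P P P)) (≅trans (Wires-releq h1 h2)
               (≅sym (≅trans (Seq-cong (Wires-sum {P}) ≅refl) (≅trans (Wires-seq (respects-sum (respects-id {P}) (respects-merge {P}))) (Wires-releq g1 g2)))))))
    where
    p = length P
    pp = length (P ++ P)
    epp : pp ≡ p + p
    epp = length-++ P
    b3 : ∀ {i W} → At (P ++ (P ++ P)) i W → i < p + (p + p)
    b3 a = subst (λ x → _ < p + x) epp (at-<length-++ P (P ++ P) a)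
    ltpp : ∀ {k} → k < p → p + k < pp
    ltpp {k} lt = subst (p + k <_) (sym epp) (+-monoʳ-< p lt)
    h1 : ∀ {i k W} → At (P ++ (P ++ P)) i W → compR (sumR pp p (mergeR p) idR) (mergeR p) i k → merge³R p i k
    h1 a (j , inj₁ (lt , inj₁ (lt' , refl)) , inj₁ (lt'' , refl)) = lt' , inj₁ refl
    h1 a (j , inj₁ (_ , inj₁ (lt' , refl)) , inj₂ refl) = ⊥-elim (m+n≮m p _ lt')
    h1 a (j , inj₁ (lt , inj₂ refl) , inj₁ (lt'' , refl)) = lt'' , inj₂ (inj₁ refl)
    h1 {k = k} a (j , inj₁ (lt , inj₂ refl) , inj₂ refl) = ⊥-elim (m+n≮m p _ (+-cancelˡ-< p _ _ (subst (p + (p + k) <_) epp lt)))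
    h1 a (j , inj₂ (i' , j' , refl , refl , refl) , inj₁ (lt'' , _)) = ⊥-elim (m+n≮m p _ lt'')
    h1 a (j , inj₂ (i' , j' , refl , refl , refl) , inj₂ e) with +-cancelˡ-≡ p _ _ e
    ... | refl = +-cancelˡ-< p _ _ (+-cancelˡ-< p _ _ (subst (_< p + (p + p)) e2 (b3 a))) , inj₂ (inj₂ e2)
      where
      e2 : pp + i' ≡ p + (p + i')
      e2 = trans (cong (_+ i') epp) (+-assoc p p i')
    h2 : ∀ {i k W} → At (P ++ (P ++ P)) i W → merge³R p i k → compR (sumR pp p (mergeR p) idR) (mergeR p) i k
    h2 {k = k} a (lt , inj₁ refl) = k , inj₁ (subst (_ <_) (sym epp) (<⇒<+ p lt) , inj₁ (lt , refl)) , inj₁ (lt , refl)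
    h2 {k = k} a (lt , inj₂ (inj₁ refl)) = k , inj₁ (ltpp lt , inj₂ refl) , inj₁ (lt , refl)
    h2 {k = k} a (lt , inj₂ (inj₂ refl)) = p + k , inj₂ (k , k , sym (trans (cong (_+ k) epp) (+-assoc p p k)) , refl , refl) , inj₂ refl
    g1 : ∀ {i k W} → At (P ++ (P ++ P)) i W → compR (sumR p p idR (mergeR p)) (mergeR p) i k → merge³R p i k
    g1 a (j , inj₁ (lt , refl) , inj₁ (_ , refl)) = lt , inj₁ refl
    g1 a (j , inj₁ (lt , refl) , inj₂ refl) = ⊥-elim (m+n≮m p _ lt)
    g1 a (j , inj₂ (i' , j' , refl , refl , inj₁ (lt' , refl)) , inj₁ (lt'' , _)) = ⊥-elim (m+n≮m p _ lt'')
    g1 a (j , inj₂ (i' , j' , refl , refl , inj₁ (lt' , refl)) , inj₂ e) with +-cancelˡ-≡ p _ _ e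
    ... | refl = lt' , inj₂ (inj₁ refl)
    g1 a (j , inj₂ (i' , j' , refl , refl , inj₂ refl) , inj₁ (lt'' , _)) = ⊥-elim (m+n≮m p _ lt'')
    g1 a (j , inj₂ (i' , j' , refl , refl , inj₂ refl) , inj₂ e) with +-cancelˡ-≡ p _ _ e
    ... | refl = +-cancelˡ-< p _ _ (+-cancelˡ-< p _ _ (b3 a)) , inj₂ (inj₂ refl)
    g2 : ∀ {i k W} → At (P ++ (P ++ P)) i W → merge³R p i k → compR (sumR p p idR (mergeR p)) (mergeR p) i k
    g2 {k = k} a (lt , inj₁ refl) = k , inj₁ (lt , refl) , inj₁ (lt , refl)
    g2 {k = k} a (lt , inj₂ (inj₁ refl)) = p + k , inj₂ (k , k , refl , refl , inj₁ (lt , refl)) , inj₂ refl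
    g2 {k = k} a (lt , inj₂ (inj₂ refl)) = p + k , inj₂ (p + k , k , refl , refl , inj₂ refl) , inj₂ refl

  sem-Δ-∷ : ∀ (U : M) (P : Pl) →
    Wires (U ∷ P) (copyR (suc (length P))) ≅
    Seq (Sum 1 2 (Wires (U ∷ []) (copyR 1)) (Wires P (copyR (length P))))
         (Sum 1 1 (Wires (U ∷ []) idR) (Sum (suc (length P)) (length (P ++ U ∷ [])) (Wires (U ∷ P) (swapR 1 (length P))) (Wires P idR)))
  sem-Δ-∷ U P = ≅sym (≅trans (Seq-cong (Wires-sum {U ∷ []}) (≅trans (Sum-cong ≅refl (Wires-sum {U ∷ P})) (Wires-sum {U ∷ []})))
                  (≅trans (Wires-seq (respects-sum (respects-copy {U ∷ []}) (respects-copy {P}))) (Wires-releq h2 h1)))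
    where
    p = length P
    pu = length (P ++ U ∷ [])
    epu : pu ≡ p + 1
    epu = length-++ P
    R1 = sumR 1 2 (copyR 1) (copyR p)
    R2 = sumR 1 1 idR (sumR (suc p) pu (swapR 1 p) idR)
    eq : ∀ i' → suc p + suc i' ≡ 1 + (pu + i')
    eq i' = cong suc (trans (sym (+-assoc p 1 i')) (cong (_+ i') (sym epu)))
    h1 : ∀ {i k W} → At (U ∷ P) i W → copyR (suc p) i k → compR R1 R2 i k
    h1 at0 (inj₁ refl) = 0 , inj₁ (s≤s z≤n , inj₁ refl) , inj₁ (s≤s z≤n , refl)
    h1 at0 (inj₂ refl) = 1 , inj₁ (s≤s z≤n , inj₂ refl) , inj₂ (0 , p + 0 , refl , refl , inj₁ (s≤s z≤n , inj₁ (s≤s z≤n , refl)))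
    h1 {suc i'} (atS a) (inj₁ refl) = 2 + i' , inj₂ (i' , i' , refl , refl , inj₁ refl) , inj₂ (1 + i' , i' , refl , refl , inj₁ (s≤s (at-<length a) , inj₂ refl))
    h1 {suc i'} (atS a) (inj₂ refl) = 2 + (p + i') , inj₂ (i' , p + i' , refl , refl , inj₂ refl) ,
        inj₂ (1 + (p + i') , pu + i' , refl , eq i' , inj₂ (i' , i' , refl , refl , refl))
    h2 : ∀ {i k W} → At (U ∷ P) i W → compR R1 R2 i k → copyR (suc p) i k
    h2 at0 (j , inj₁ (_ , inj₁ refl) , inj₁ (_ , refl)) = inj₁ refl
    h2 at0 (j , inj₁ (_ , inj₁ refl) , inj₂ (_ , _ , () , _))
    h2 at0 (j , inj₁ (_ , inj₂ refl) , inj₁ (s≤s () , _))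
    h2 at0 (j , inj₁ (_ , inj₂ refl) , inj₂ (.0 , k2 , refl , refl , inj₁ (_ , inj₁ (_ , refl)))) = inj₂ refl
    h2 at0 (j , inj₁ (_ , inj₂ refl) , inj₂ (.0 , k2 , refl , refl , inj₁ (_ , inj₂ ())))
    h2 at0 (j , inj₁ (_ , inj₂ refl) , inj₂ (.0 , k2 , refl , refl , inj₂ (_ , _ , () , _)))
    h2 at0 (j , inj₂ (_ , _ , () , _) , _)
    h2 (atS a) (j , inj₁ (s≤s () , _) , _)
    h2 (atS a) (j , inj₂ (i'' , j'' , refl , refl , rd) , inj₁ (s≤s () , _))
    h2 (atS a) (j , inj₂ (i'' , j'' , refl , refl , rd) , inj₂ (.(suc j'') , k2 , refl , refl , inj₁ (lt , inj₁ (s≤s () , _))))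
    h2 (atS a) (j , inj₂ (i'' , j'' , refl , refl , inj₁ refl) , inj₂ (.(suc j'') , k2 , refl , refl , inj₁ (lt , inj₂ refl))) = inj₁ refl
    h2 (atS a) (j , inj₂ (i'' , j'' , refl , refl , inj₂ refl) , inj₂ (.(suc j'') , k2 , refl , refl , inj₁ (s≤s lt , inj₂ refl))) = ⊥-elim (m+n≮m p _ lt)
    h2 (atS a) (j , inj₂ (i'' , j'' , refl , refl , inj₁ refl) , inj₂ (.(suc j'') , k2 , refl , refl , inj₂ (i3 , k3 , refl , refl , refl))) = ⊥-elim (at-beyond P a)
    h2 (atS a) (j , inj₂ (i'' , j'' , refl , refl , inj₂ e) , inj₂ (.(suc j'') , k2 , refl , refl , inj₂ (i3 , k3 , e' , refl , refl))) with +-cancelˡ-≡ p _ _ (trans (sym e) (cong pred e'))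
    ... | refl = inj₂ (sym (eq i''))

  sem-∇-∷ : ∀ (U : M) (P : Pl) →
    Wires (U ∷ (P ++ U ∷ P)) (mergeR (suc (length P))) ≅
    Seq (Sum 1 1 (Wires (U ∷ []) idR) (Sum (length (P ++ U ∷ [])) (suc (length P)) (Wires (P ++ U ∷ []) (swapR (length P) 1)) (Wires P idR)))
         (Sum 2 1 (Wires (U ∷ U ∷ []) (mergeR 1)) (Wires (P ++ P) (mergeR (length P))))
  sem-∇-∷ U P = ≅sym (≅trans (Seq-cong (≅trans (Sum-cong ≅refl (Wires-sum {P ++ U ∷ []})) (Wires-sum {U ∷ []})) (Wires-sum {U ∷ U ∷ []}))
                  (≅trans (Wires-seq (respects-sum (respects-id {U ∷ []}) (respects-sum (respects-swap {P} {U ∷ []}) (respects-id {P}))))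
                  (≅trans (Wires-list (cong (U ∷_) (++-assoc P (U ∷ []) P))) (Wires-releq h1 h2))))
    where
    p = length P
    pu = length (P ++ U ∷ [])
    epu : pu ≡ p + 1
    epu = length-++ P
    R1 = sumR 1 1 idR (sumR pu (suc p) (swapR p 1) idR)
    R2 = sumR 2 1 (mergeR 1) (mergeR p)
    eq : ∀ i' → suc p + suc i' ≡ suc (pu + i')
    eq i' = cong suc (trans (sym (+-assoc p 1 i')) (cong (_+ i') (sym epu)))
    lpu : ∀ {i} → i < p → i < pu
    lpu {i} lt = subst (i <_) (sym epu) (<⇒<+ 1 lt)
    h1 : ∀ {i k W} → At (U ∷ (P ++ U ∷ P)) i W → compR R1 R2 i k → mergeR (suc p) i k
    h1 at0 (j , inj₁ (_ , refl) , inj₁ (_ , inj₁ (_ , refl))) = inj₁ (s≤s z≤n , refl)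
    h1 at0 (j , inj₁ (_ , refl) , inj₁ (_ , inj₂ ()))
    h1 at0 (j , inj₁ (_ , refl) , inj₂ (_ , _ , () , _))
    h1 at0 (j , inj₂ (_ , _ , () , _) , _)
    h1 (atS a) (j , inj₁ (s≤s () , _) , _)
    h1 (atS a) (j , inj₂ (i' , j' , refl , refl , inj₁ (lt , inj₁ (lt' , refl))) , inj₁ (s≤s (s≤s ()) , _))
    h1 (atS a) (j , inj₂ (i' , j' , refl , refl , inj₁ (lt , inj₁ (lt' , refl))) , inj₂ (.i' , k2 , refl , refl , inj₁ (_ , refl))) = inj₁ (s≤s lt' , refl)
    h1 (atS a) (j , inj₂ (i' , j' , refl , refl , inj₁ (lt , inj₁ (lt' , refl))) , inj₂ (.i' , k2 , refl , refl , inj₂ refl)) = ⊥-elim (m+n≮m p _ lt')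
    h1 (atS a) (j , inj₂ (i' , zero , refl , refl , inj₁ (lt , inj₂ refl)) , inj₁ (_ , inj₁ (s≤s () , _)))
    h1 (atS a) (j , inj₂ (i' , zero , refl , refl , inj₁ (lt , inj₂ refl)) , inj₁ (_ , inj₂ refl)) = inj₂ refl
    h1 (atS a) (j , inj₂ (i' , zero , refl , refl , inj₁ (lt , inj₂ refl)) , inj₂ (_ , _ , () , _))
    h1 (atS a) (j , inj₂ (i' , suc j' , refl , refl , inj₁ (lt , inj₂ refl)) , _) with +-cancelˡ-< p _ _ (subst (p + suc j' <_) epu lt)
    ... | s≤s ()
    h1 (atS a) (j , inj₂ (i' , j' , refl , refl , inj₂ (i3 , j3 , refl , refl , refl)) , inj₁ (s≤s (s≤s ()) , _))
    h1 (atS a) (j , inj₂ (i' , j' , refl , refl , inj₂ (i3 , j3 , refl , refl , refl)) , inj₂ (_ , k2 , refl , refl , inj₁ (lt , _))) = ⊥-elim (m+n≮m p _ lt)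
    h1 (atS a) (j , inj₂ (i' , j' , refl , refl , inj₂ (i3 , j3 , refl , refl , refl)) , inj₂ (_ , k2 , refl , refl , inj₂ e)) with +-cancelˡ-≡ p _ _ e
    ... | refl = inj₂ (sym (eq i3))
    h2 : ∀ {i k W} → At (U ∷ (P ++ U ∷ P)) i W → mergeR (suc p) i k → compR R1 R2 i k
    h2 at0 (inj₁ (_ , refl)) = 0 , inj₁ (s≤s z≤n , refl) , inj₁ (s≤s z≤n , inj₁ (s≤s z≤n , refl))
    h2 (atS {n = i'} a) (inj₁ (s≤s lt , refl)) = 2 + i' , inj₂ (i' , 1 + i' , refl , refl , inj₁ (lpu lt , inj₁ (lt , refl))) ,
                                                 inj₂ (i' , i' , refl , refl , inj₁ (lt , refl))
    h2 {k = zero} (atS a) (inj₂ refl) = 1 , inj₂ (p + 0 , 0 , refl , refl , inj₁ (lpu0 , inj₂ refl)) , inj₁ (s≤s (s≤s z≤n) , inj₂ refl)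
      where
      lpu0 : p + 0 < pu
      lpu0 = subst₂ _<_ (sym (+-identityʳ p)) (sym epu) (m<m+n p (s≤s z≤n))
    h2 {k = suc k'} (atS a) (inj₂ refl) = 2 + (p + k') , inj₂ (p + suc k' , suc p + k' , refl , refl , inj₂ (k' , k' , ek , refl , refl)) ,
                                          inj₂ (p + k' , k' , refl , refl , inj₂ refl)
      where
      ek : p + suc k' ≡ pu + k'
      ek = cong pred (eq k')

  sem-⊕-assoc : ∀ (P R Q S : Pl) {A B E} →
    Sum (length (P ++ R)) (length (Q ++ S)) (Sum (length P) (length Q) A B) E ≅ Sum (length P) (length Q) A (Sum (length R) (length S) B E)
  sem-⊕-assoc P R Q S rewrite length-++ P {R} | length-++ Q {S} = sem-⊕-assoc-ℕ (length P) (length R) (length Q) (length S)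

  sem-id⊕id : ∀ (P Q : Pl) → Sum (length P) (length P) (Wires P idR) (Wires Q idR) ≅ Wires (P ++ Q) idR
  sem-id⊕id P Q = ≅trans (Wires-sum {P}) (Wires-releq h1 h2)
    where
    p = length P
    h1 : ∀ {i k W} → At (P ++ Q) i W → sumR p p idR idR i k → idR i k
    h1 a (inj₁ (_ , e)) = e
    h1 a (inj₂ (i' , j' , refl , refl , refl)) = refl
    h2 : ∀ {i k W} → At (P ++ Q) i W → idR i k → sumR p p idR idR i k
    h2 {i} a refl with <⊎≡+ p i
    ... | inj₁ lt = inj₁ (lt , refl)
    ... | inj₂ (j , refl) = inj₂ (j , j , refl , refl , refl)

  sem-interchange : ∀ {P Q R A B A' B'} → WellTyped P Q A → WellTyped Q R B →
    Sum (length P) (length R) (Seq A B) (Seq A' B') ≅ Seq (Sum (length P) (length Q) A A') (Sum (length Q) (length R) B B')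
  sem-interchange {P} {Q} {R} {A = A} {B = B} {A' = A'} {B' = B'} tA tB =
      (λ { (left (seq a b le)) → seq (left a) (left b) le ; (right refl refl (seq a b le)) → seq (right refl refl a) (right refl refl b) le })
    , g
    where
    q = length Q
    g : Seq (Sum (length P) q A A') (Sum q (length R) B B') ⊆ Sum (length P) (length R) (Seq A B) (Seq A' B')
    g (seq (left a) (left b) le) = left (seq a b le)
    g (seq (left a) (right e f b) le) = ⊥-elim (at-beyond-≡ Q e (proj₂ (tA a)))
    g (seq (right e₁ e₂ a) (left b) le) = ⊥-elim (at-beyond-≡ Q e₂ (proj₁ (tB b)))
    g (seq (right {j' = j₁} e₁ e₂ a) (right {i' = j₂} e₃ e₄ b) le) with +-cancelˡ-≡ q _ _ (trans (sym e₂) e₃)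
    ... | refl = right e₁ e₄ (seq a b le)

  sem-σ-nat : ∀ {P Q P' Q' A B} → WellTyped P Q A → WellTyped P' Q' B →
    Seq (Sum (length P) (length Q) A B) (Wires (Q ++ Q') (swapR (length Q) (length Q'))) ≅
    Seq (Wires (P ++ P') (swapR (length P) (length P'))) (Sum (length P') (length Q') B A)
  sem-σ-nat {P} {Q} {P'} {Q'} {A} {B} tA tB = f , g
    where
    p = length P
    q = length Q
    f : Seq (Sum p q A B) (Wires (Q ++ Q') (swapR q (length Q'))) ⊆ Seq (Wires (P ++ P') (swapR p (length P'))) (Sum (length P') (length Q') B A)
    f (seq (left a) (wire _ (inj₁ (_ , e)) l2) le) = seq (wire (at-++ˡ (proj₁ (tA a))) (inj₁ (at-<length (proj₁ (tA a)) , refl)) ≤refl) (right refl e a) (≤-padˡ (≤⨾-dropʳ le l2))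
    f (seq (left a) (wire _ (inj₂ e) l2) le) = ⊥-elim (at-beyond-≡ Q e (proj₂ (tA a)))
    f (seq (right refl refl b) (wire _ (inj₁ (lt , _)) l2) le) = ⊥-elim (m+n≮m q _ lt)
    f (seq (right refl refl b) (wire _ (inj₂ e) l2) le) with +-cancelˡ-≡ q _ _ e
    ... | refl = seq (wire (at-++ʳ P (proj₁ (tB b))) (inj₂ refl) ≤refl) (left b) (≤-padˡ (≤⨾-dropʳ le l2))
    g : Seq (Wires (P ++ P') (swapR p (length P'))) (Sum (length P') (length Q') B A) ⊆ Seq (Sum p q A B) (Wires (Q ++ Q') (swapR q (length Q')))
    g (seq (wire a (inj₁ (lt , refl)) l1) (left b) le) = ⊥-elim (at-beyond P' (proj₁ (tB b)))
    g (seq (wire a (inj₁ (lt , refl)) l1) (right e f x) le) with +-cancelˡ-≡ (length P') _ _ e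
    ... | refl = seq (left x) (wire (at-++ˡ (proj₂ (tA x))) (inj₁ (at-<length (proj₂ (tA x)) , f)) ≤refl) (≤-padʳ (≤⨾-dropˡ le l1))
    g (seq (wire a (inj₂ refl) l1) (left b) le) = seq (right refl refl b) (wire (at-++ʳ Q (proj₂ (tB b))) (inj₂ refl) ≤refl) (≤-padʳ (≤⨾-dropˡ le l1))
    g (seq (wire a (inj₂ refl) l1) (right e f x) le) = ⊥-elim (at-beyond-≡ P' e (at-++ʳ⁻ P a))

  sem-Δ-nat : ∀ {P Q A} → WellTyped P Q A → Seq A (Wires Q (copyR (length Q))) ≅ Seq (Wires P (copyR (length P))) (Sum (length P) (length Q) A A)
  sem-Δ-nat {P} {Q} {A} tA = f , g
    where
    p = length P
    q = length Q
    f : Seq A (Wires Q (copyR q)) ⊆ Seq (Wires P (copyR p)) (Sum p q A A)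
    f (seq a (wire _ (inj₁ refl) l2) le) = seq (wire (proj₁ (tA a)) (inj₁ refl) ≤refl) (left a) (≤-padˡ (≤⨾-dropʳ le l2))
    f (seq a (wire _ (inj₂ refl) l2) le) = seq (wire (proj₁ (tA a)) (inj₂ refl) ≤refl) (right refl refl a) (≤-padˡ (≤⨾-dropʳ le l2))
    g : Seq (Wires P (copyR p)) (Sum p q A A) ⊆ Seq A (Wires Q (copyR q))
    g (seq (wire a (inj₁ refl) l1) (left x) le) = seq x (wire (proj₂ (tA x)) (inj₁ refl) ≤refl) (≤-padʳ (≤⨾-dropˡ le l1))
    g (seq (wire a (inj₁ refl) l1) (right e f x) le) = ⊥-elim (at-beyond-≡ P e a)
    g (seq (wire a (inj₂ refl) l1) (left x) le) = ⊥-elim (at-beyond P (proj₁ (tA x)))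
    g (seq (wire a (inj₂ refl) l1) (right e f x) le) with +-cancelˡ-≡ p _ _ e
    ... | refl = seq x (wire (proj₂ (tA x)) (inj₂ f) ≤refl) (≤-padʳ (≤⨾-dropˡ le l1))

  sem-∇-nat : ∀ {P Q A} → WellTyped P Q A → Seq (Wires (P ++ P) (mergeR (length P))) A ≅ Seq (Sum (length P) (length Q) A A) (Wires (Q ++ Q) (mergeR (length Q)))
  sem-∇-nat {P} {Q} {A} tA = f , g
    where
    p = length P
    q = length Q
    f : Seq (Wires (P ++ P) (mergeR p)) A ⊆ Seq (Sum p q A A) (Wires (Q ++ Q) (mergeR q))
    f (seq (wire _ (inj₁ (lt , refl)) l1) a le) = seq (left a) (wire (at-++ˡ (proj₂ (tA a))) (inj₁ (at-<length (proj₂ (tA a)) , refl)) ≤refl) (≤-padʳ (≤⨾-dropˡ le l1))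
    f (seq (wire _ (inj₂ refl) l1) a le) = seq (right refl refl a) (wire (at-++ʳ Q (proj₂ (tA a))) (inj₂ refl) ≤refl) (≤-padʳ (≤⨾-dropˡ le l1))
    g : Seq (Sum p q A A) (Wires (Q ++ Q) (mergeR q)) ⊆ Seq (Wires (P ++ P) (mergeR p)) A
    g (seq (left a) (wire _ (inj₁ (lt , refl)) l2) le) = seq (wire (at-++ˡ (proj₁ (tA a))) (inj₁ (at-<length (proj₁ (tA a)) , refl)) ≤refl) a (≤-padˡ (≤⨾-dropʳ le l2))
    g (seq (left a) (wire _ (inj₂ e) l2) le) = ⊥-elim (at-beyond-≡ Q e (proj₂ (tA a)))
    g (seq (right e refl a) (wire _ (inj₁ (lt , refl)) l2) le) = ⊥-elim (m+n≮m q _ lt)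
    g (seq (right refl refl a) (wire _ (inj₂ e) l2) le) with +-cancelˡ-≡ q _ _ e
    ... | refl = seq (wire (at-++ʳ P (proj₁ (tA a))) (inj₂ refl) ≤refl) a (≤-padˡ (≤⨾-dropʳ le l2))

  sem-⌈id⌉ : ∀ (u : M) → Below (idC u) ≅ Wires (u ∷ []) idR
  sem-⌈id⌉ u = (λ { (below le) → wire at0 refl le }) , (λ { (wire at0 refl le) → below le })

  sem-⌈⨾⌉ : ∀ {u v w} (c : C u v) (d : C v w) → Below (c ⨾C d) ≅ Seq (Below c) (Below d)
  sem-⌈⨾⌉ c d = (λ { (below le) → seq (below ≤refl) (below ≤refl) le }) , (λ { (seq (below l1) (below l2) le) → below (le ⟫ ⨾-mono l1 l2) })

  sem-⌈⌉-cong : ∀ {u v u' v'} {c : C u v} {d : C u' v'} → c ≈C d → Below c ≅ Below d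
  sem-⌈⌉-cong {c = c} {d} e with ≈C-endpoints e
  ... | refl , refl = (λ { (below le) → below (le ⟫ ≈⇒≤ e) }) , (λ { (below le) → below (le ⟫ ≈⇒≤ (≈sym e)) })

  D-cong : ∀ {P Q P' Q'} {t : Tape 𝒮 P Q} {s : Tape 𝒮 P' Q'} → t ≈T s → D t ≅ D s
  D-cong ≈refl = ≅refl
  D-cong (≈sym e) = ≅sym (D-cong e)
  D-cong (≈trans e f) = ≅trans (D-cong e) (D-cong f)
  D-cong (⨾-cong e f) = Seq-cong (D-cong e) (D-cong f)
  D-cong (⊕-cong e f) with ≈T-endpoints e | ≈T-endpoints f
  ... | refl , refl | refl , refl = Sum-cong (D-cong e) (D-cong f)
  D-cong (idˡ t) = sem-idˡ (D-typed t) (D-down t)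
  D-cong (idʳ t) = sem-idʳ (D-typed t) (D-down t)
  D-cong (⨾-assoc t s r) = sem-⨾-assoc
  D-cong (⊕-assoc {P} {Q} {R} {S} t s r) = sem-⊕-assoc P R Q S
  D-cong (⊕-unitˡ t) = sem-⊕-unitˡ
  D-cong (⊕-unitʳ t) = sem-⊕-unitʳ
  D-cong (id⊕id P Q) = sem-id⊕id P Q
  D-cong (interchange t s t' s') = sem-interchange (D-typed t) (D-typed s)
  D-cong (σ-nat t s) = sem-σ-nat (D-typed t) (D-typed s)
  D-cong (σ-inv P Q) = sem-σ-inv P Q
  D-cong (σ-unit P) = sem-σ-unit P
  D-cong (σ-hex P U R) = sem-σ-hex P U R
  D-cong (⌈⌉-cong e) = sem-⌈⌉-cong e
  D-cong (⌈id⌉ u) = sem-⌈id⌉ u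
  D-cong (⌈⨾⌉ c d) = sem-⌈⨾⌉ c d
  D-cong (∇-assoc P) = sem-∇-assoc P
  D-cong (∇-unit P) = sem-∇-unit P
  D-cong (∇-comm P) = sem-∇-comm P
  D-cong (Δ-assoc P) = sem-Δ-assoc P
  D-cong (Δ-unit P) = sem-Δ-unit P
  D-cong (Δ-comm P) = sem-Δ-comm P
  D-cong (Δ-nat t) = sem-Δ-nat (D-typed t)
  D-cong (!-nat t) = Seq-Emptyʳ
  D-cong (∇-nat t) = sem-∇-nat (D-typed t)
  D-cong (¡-nat t) = Seq-Emptyˡ
  D-cong Δ-[] = Wires-[]
  D-cong (Δ-∷ U P) = sem-Δ-∷ U P
  D-cong !-[] = Empty≅Wires-[]
  D-cong (!-∷ U P) = Empty≅Sum
  D-cong ∇-[] = Wires-[]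
  D-cong (∇-∷ U P) = sem-∇-∷ U P
  D-cong ¡-[] = Empty≅Wires-[]
  D-cong (¡-∷ U P) = Empty≅Sum

  -- The action of id_U ⊗ - or - ⊗ id_V on circuits, monomials and positions.
  record Whiskering : Set where
    field
      onMono : M → M
      onCirc : ∀ {u v} → C u v → C (onMono u) (onMono v)
      onPoly : Pl → Pl
      onCirc-mono : ∀ {u v} {c d : C u v} → c ≤C d → onCirc c ≤C onCirc d
      onCirc-id : ∀ {u} → onCirc (idC u) ≈C idC (onMono u)
      onCirc-⨾ : ∀ {u v w} (c : C u v) (d : C v w) → onCirc (c ⨾C d) ≈C (onCirc c ⨾C onCirc d)
      at-onPoly : ∀ {P i W} → At P i W → At (onPoly P) i (onMono W)
      at-onPoly⁻ : ∀ {P i X} → At (onPoly P) i X → Σ M (λ W → (X ≡ onMono W) × At P i W)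

  module _ (Φ : Whiskering) where
    open Whiskering Φ

    cast : ∀ {X Y W W'} → X ≡ onMono W → Y ≡ onMono W' → C (onMono W) (onMono W') → C X Y
    cast refl refl c = c

    data Image (A : Den) : ℕ → ℕ → ∀ {X Y : M} → C X Y → Set where
      image : ∀ {i j X Y W W'} {c : C X Y} (c₀ : C W W') (eX : X ≡ onMono W) (eY : Y ≡ onMono W') →
            A i j c₀ → c ≤C cast eX eY (onCirc c₀) → Image A i j c

    Image-mono : ∀ {A A'} → A ⊆ A' → Image A ⊆ Image A'
    Image-mono f (image c₀ eX eY a le) = image c₀ eX eY (f a) le

    Image-Below : ∀ {u v} (c : C u v) → Image (Below c) ≅ Below (onCirc c)
    Image-Below c = (λ { (image c₀ refl refl (below l0) le) → below (le ⟫ onCirc-mono l0) })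
              , (λ { (below le) → image c refl refl (below ≤refl) le })

    Image-Wires : ∀ {P R} → Image (Wires P R) ≅ Wires (onPoly P) R
    Image-Wires = (λ { (image c₀ refl refl (wire a r l0) le) → wire (at-onPoly a) r (le ⟫ onCirc-mono l0 ⟫ ≈⇒≤ onCirc-id) })
            , g
      where
      g : ∀ {P R} → Wires (onPoly P) R ⊆ Image (Wires P R)
      g (wire a r le) with at-onPoly⁻ a
      ... | W , refl , a' = image (idC W) refl refl (wire a' r ≤refl) (le ⟫ ≈⇒≤ (≈sym onCirc-id))

    Image-Empty : Image Empty ≅ Empty
    Image-Empty = (λ { (image _ _ _ () _) }) , (λ ())

    Image-Sum : ∀ {n m A B} → Image (Sum n m A B) ≅ Sum n m (Image A) (Image B)
    Image-Sum = (λ { (image c₀ eX eY (left a) le) → left (image c₀ eX eY a le) ; (image c₀ eX eY (right e f b) le) → right e f (image c₀ eX eY b le) })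
            , (λ { (left (image c₀ eX eY a le)) → image c₀ eX eY (left a) le ; (right e f (image c₀ eX eY b le)) → image c₀ eX eY (right e f b) le })

    Image-Seq : ∀ {P Q R A B} → WellTyped P Q A → WellTyped Q R B → Image (Seq A B) ≅ Seq (Image A) (Image B)
    Image-Seq {A = A} {B} tA tB =
        (λ { (image c₀ refl refl (seq a b l0) le) → seq (image _ refl refl a ≤refl) (image _ refl refl b ≤refl) (le ⟫ onCirc-mono l0 ⟫ ≈⇒≤ (onCirc-⨾ _ _)) })
      , g
      where
      g : Seq (Image A) (Image B) ⊆ Image (Seq A B)
      g (seq (image c₁ refl refl a l1) (image c₂ eY' refl b l2) le) with at-functional (proj₂ (tA a)) (proj₁ (tB b))
      ... | refl with eY'
      ... | refl = image (c₁ ⨾C c₂) refl refl (seq a b ≤refl) (le ⟫ ⨾-mono l1 l2 ⟫ ≈⇒≤ (≈sym (onCirc-⨾ c₁ c₂)))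

  coe-strip : ∀ {P P' Q' Q} (e₁ : P ≡ P') (x : Tape 𝒮 P' Q') (e₂ : Q' ≡ Q) → D (coe e₁ ⨾ x ⨾ coe e₂) ≅ D x
  coe-strip refl x refl = ≅trans (Seq-cong ≅refl (sem-idʳ (D-typed x) (D-down x))) (sem-idˡ (D-typed x) (D-down x))

  coe-stripˡ : ∀ {P P' Q'} (e₁ : P ≡ P') (x : Tape 𝒮 P' Q') → D (coe e₁ ⨾ x) ≅ D x
  coe-stripˡ refl x = sem-idˡ (D-typed x) (D-down x)

  coe-stripʳ : ∀ {P' Q' Q} (x : Tape 𝒮 P' Q') (e₂ : Q' ≡ Q) → D (x ⨾ coe e₂) ≅ D x
  coe-stripʳ x refl = sem-idʳ (D-typed x) (D-down x)

  Sum-len : ∀ {n n' m m' A B} → n ≡ n' → m ≡ m' → Sum n m A B ≅ Sum n' m' A B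
  Sum-len refl refl = ≅refl

  swapR-len : ∀ {P n n' m m'} → n ≡ n' → m ≡ m' → Wires P (swapR n m) ≅ Wires P (swapR n' m')
  swapR-len refl refl = ≅refl
  copyR-len : ∀ {P n n'} → n ≡ n' → Wires P (copyR n) ≅ Wires P (copyR n')
  copyR-len refl = ≅refl
  mergeR-len : ∀ {P n n'} → n ≡ n' → Wires P (mergeR n) ≅ Wires P (mergeR n')
  mergeR-len refl = ≅refl

  whiskerˡ : M → Whiskering
  whiskerˡ U = record
    { onMono = U ++_
    ; onCirc = λ c → idC U ⊗C c
    ; onPoly = U ⊠′_
    ; onCirc-mono = λ le → ⊗-mono ≤refl le
    ; onCirc-id = λ {u} → id⊗id U u
    ; onCirc-⨾ = λ c d → ≈trans (⊗-cong (≈sym (idˡ (idC U))) ≈refl) (interchange (idC U) (idC U) c d)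
    ; at-onPoly = at-map (U ++_)
    ; at-onPoly⁻ = at-map⁻ (U ++_)
    }

  D-wl : ∀ (U : M) {P Q} (t : Tape 𝒮 P Q) → D (wl U t) ≅ Image (whiskerˡ U) (D t)
  D-wl U ⌈ c ⌉ = ≅sym (Image-Below (whiskerˡ U) c)
  D-wl U (idT P) = ≅sym (Image-Wires (whiskerˡ U))
  D-wl U (σ⊕ P Q) = ≅trans (coe-strip (map-++ (U ++_) P Q) (σ⊕ (U ⊠′ P) (U ⊠′ Q)) (sym (map-++ (U ++_) Q P)))
                   (≅trans (swapR-len (length-map (U ++_) P) (length-map (U ++_) Q))
                   (≅trans (Wires-list (sym (map-++ (U ++_) P Q))) (≅sym (Image-Wires (whiskerˡ U)))))
  D-wl U (Δ P) = ≅trans (coe-stripʳ (Δ (U ⊠′ P)) (sym (map-++ (U ++_) P P)))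
                (≅trans (copyR-len (length-map (U ++_) P)) (≅sym (Image-Wires (whiskerˡ U))))
  D-wl U (! P) = ≅sym (Image-Empty (whiskerˡ U))
  D-wl U (∇ P) = ≅trans (coe-stripˡ (map-++ (U ++_) P P) (∇ (U ⊠′ P)))
                (≅trans (mergeR-len (length-map (U ++_) P)) (≅trans (Wires-list (sym (map-++ (U ++_) P P))) (≅sym (Image-Wires (whiskerˡ U)))))
  D-wl U (¡ P) = ≅sym (Image-Empty (whiskerˡ U))
  D-wl U (t ⨾ s) = ≅trans (Seq-cong (D-wl U t) (D-wl U s)) (≅sym (Image-Seq (whiskerˡ U) (D-typed t) (D-typed s)))
  D-wl U (_⊕_ {P} {Q} {P'} {Q'} t s) = ≅trans (coe-strip (map-++ (U ++_) P P') (wl U t ⊕ wl U s) (sym (map-++ (U ++_) Q Q')))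
                (≅trans (Sum-len (length-map (U ++_) P) (length-map (U ++_) Q))
                (≅trans (Sum-cong (D-wl U t) (D-wl U s)) (≅sym (Image-Sum (whiskerˡ U)))))

  at-⊗[V] : ∀ (V : M) {P i W} → At P i W → At (P ⊗′ (V ∷ [])) i (W ++ V)
  at-⊗[V] V at0 = at0
  at-⊗[V] V (atS a) = atS (at-⊗[V] V a)

  at-⊗[V]⁻ : ∀ (V : M) {P i X} → At (P ⊗′ (V ∷ [])) i X → Σ M (λ W → (X ≡ W ++ V) × At P i W)
  at-⊗[V]⁻ V {U ∷ P} at0 = U , refl , at0
  at-⊗[V]⁻ V {U ∷ P} (atS a) with at-⊗[V]⁻ V a
  ... | W , e , b = W , e , atS b

  length-⊗[V] : ∀ (V : M) P → length (P ⊗′ (V ∷ [])) ≡ length P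
  length-⊗[V] V [] = refl
  length-⊗[V] V (U ∷ P) = cong suc (length-⊗[V] V P)

  whiskerʳ : M → Whiskering
  whiskerʳ V = record
    { onMono = _++ V
    ; onCirc = λ c → c ⊗C idC V
    ; onPoly = _⊗′ (V ∷ [])
    ; onCirc-mono = λ le → ⊗-mono le ≤refl
    ; onCirc-id = λ {u} → id⊗id u V
    ; onCirc-⨾ = λ c d → ≈trans (⊗-cong ≈refl (≈sym (idˡ (idC V)))) (interchange c d (idC V) (idC V))
    ; at-onPoly = at-⊗[V] V
    ; at-onPoly⁻ = at-⊗[V]⁻ V
    }

  D-wr : ∀ (V : M) {P Q} (t : Tape 𝒮 P Q) → D (wr V t) ≅ Image (whiskerʳ V) (D t)
  D-wr V ⌈ c ⌉ = ≅sym (Image-Below (whiskerʳ V) c)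
  D-wr V (idT P) = ≅sym (Image-Wires (whiskerʳ V))
  D-wr V (σ⊕ P Q) = ≅trans (coe-strip (⊗P-++ {𝒮} P Q (V ∷ [])) (σ⊕ (P ⊗′ (V ∷ [])) (Q ⊗′ (V ∷ []))) (sym (⊗P-++ {𝒮} Q P (V ∷ []))))
                   (≅trans (swapR-len (length-⊗[V] V P) (length-⊗[V] V Q))
                   (≅trans (Wires-list (sym (⊗P-++ {𝒮} P Q (V ∷ [])))) (≅sym (Image-Wires (whiskerʳ V)))))
  D-wr V (Δ P) = ≅trans (coe-stripʳ (Δ (P ⊗′ (V ∷ []))) (sym (⊗P-++ {𝒮} P P (V ∷ []))))
                (≅trans (copyR-len (length-⊗[V] V P)) (≅sym (Image-Wires (whiskerʳ V))))
  D-wr V (! P) = ≅sym (Image-Empty (whiskerʳ V))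
  D-wr V (∇ P) = ≅trans (coe-stripˡ (⊗P-++ {𝒮} P P (V ∷ [])) (∇ (P ⊗′ (V ∷ []))))
                (≅trans (mergeR-len (length-⊗[V] V P)) (≅trans (Wires-list (sym (⊗P-++ {𝒮} P P (V ∷ [])))) (≅sym (Image-Wires (whiskerʳ V)))))
  D-wr V (¡ P) = ≅sym (Image-Empty (whiskerʳ V))
  D-wr V (t ⨾ s) = ≅trans (Seq-cong (D-wr V t) (D-wr V s)) (≅sym (Image-Seq (whiskerʳ V) (D-typed t) (D-typed s)))
  D-wr V (_⊕_ {P} {Q} {P'} {Q'} t s) = ≅trans (coe-strip (⊗P-++ {𝒮} P P' (V ∷ [])) (wr V t ⊕ wr V s) (sym (⊗P-++ {𝒮} Q Q' (V ∷ []))))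
                (≅trans (Sum-len (length-⊗[V] V P) (length-⊗[V] V Q))
                (≅trans (Sum-cong (D-wr V t) (D-wr V s)) (≅sym (Image-Sum (whiskerʳ V)))))

  wl-mono : ∀ (U : M) {P Q} (t t' : Tape 𝒮 P Q) → D t ⊆ D t' → D (wl U t) ⊆ D (wl U t')
  wl-mono U t t' h x = proj₂ (D-wl U t') (Image-mono (whiskerˡ U) h (proj₁ (D-wl U t) x))

  wr-mono : ∀ (V : M) {P Q} (t t' : Tape 𝒮 P Q) → D t ⊆ D t' → D (wr V t) ⊆ D (wr V t')
  wr-mono V t t' h x = proj₂ (D-wr V t') (Image-mono (whiskerʳ V) h (proj₁ (D-wr V t) x))

  wlP-mono : ∀ (P : Pl) {Q Q'} (t t' : Tape 𝒮 Q Q') → D t ⊆ D t' → D (wlP P t) ⊆ D (wlP P t')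
  wlP-mono [] t t' h x = x
  wlP-mono (U ∷ P) t t' h = Sum-mono (wl-mono U t t' h) (wlP-mono P t t' h)

  wrP-mono : ∀ (Q : Pl) {P P'} (t t' : Tape 𝒮 P P') → D t ⊆ D t' → D (wrP Q t) ⊆ D (wrP Q t')
  wrP-mono [] t t' h x = x
  wrP-mono (V ∷ Q) t t' h = Seq-mono (λ x → x) (Seq-mono (Sum-mono (wr-mono V t t' h) (wrP-mono Q t t' h)) (λ x → x))

  ⊗T-mono : ∀ {P Q P' Q'} (t t' : Tape 𝒮 P Q) (s s' : Tape 𝒮 P' Q') → D t ⊆ D t' → D s ⊆ D s' → D (t ⊗T s) ⊆ D (t' ⊗T s')
  ⊗T-mono {P} {Q} {P'} {Q'} t t' s s' h h' = Seq-mono (wlP-mono P s s' h') (wrP-mono Q' t t' h)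

  D-mono : ∀ {P Q} {t s : Tape 𝒮 P Q} → LeT 𝕀 t s → D t ⊆ D s
  D-mono (ax x) (below le) = below (le ⟫ ax x)
  D-mono (¡! U) (wire () _ _)
  D-mono (!¡ U) (seq _ () _)
  D-mono (∇Δ U) (left (wire at0 refl le)) = seq (wire at0 (inj₁ (s≤s z≤n , refl)) ≤refl) (wire at0 (inj₁ refl) ≤refl) (≤-padˡ le ⟫ ⨾-mono ≤refl ≤refl)
  D-mono (∇Δ U) (right refl refl (wire at0 refl le)) = seq (wire (atS at0) (inj₂ refl) ≤refl) (wire at0 (inj₂ refl) ≤refl) (≤-padˡ le)
  D-mono (Δ∇ U) (seq (wire at0 (inj₁ refl) l1) (wire a2 (inj₁ (_ , refl)) l2) le) = wire at0 refl (≤⨾-id le l1 l2)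
  D-mono (Δ∇ U) (seq (wire at0 (inj₁ refl) l1) (wire a2 (inj₂ ()) l2) le)
  D-mono (Δ∇ U) (seq (wire at0 (inj₂ refl) l1) (wire a2 (inj₁ (s≤s () , _)) l2) le)
  D-mono (Δ∇ U) (seq (wire at0 (inj₂ refl) l1) (wire a2 (inj₂ refl) l2) le) = wire at0 refl (≤⨾-id le l1 l2)
  D-mono (≈⇒≤ e) = proj₁ (D-cong e)
  D-mono (≤trans p q) x = D-mono q (D-mono p x)
  D-mono (⨾-mono p q) = Seq-mono (D-mono p) (D-mono q)
  D-mono (⊕-mono p q) = Sum-mono (D-mono p) (D-mono q)
  D-mono (⊗-mono {t = t} {t'} {s} {s'} p q) = ⊗T-mono t t' s s' (D-mono p) (D-mono q)

-- The characterisation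

module Characterisation {𝒮 : Signature} (𝕀 : Theory 𝒮) where
  private
    M : Set
    M = Mono 𝒮
    Pl : Set
    Pl = Poly 𝒮
    C : M → M → Set
    C = Circ 𝒮
    T : Pl → Pl → Set
    T = Tape 𝒮

  open Denotation 𝕀

  δ-singleton : ∀ (u v : M) → δ {𝒮} (u ∷ []) v [] ≈T idT ((u ++ v) ∷ [])
  δ-singleton u v = ≈trans (⊕ʳ tail≈id) (⊕-unitʳ _)
    where
    tail≈id = ≈trans (⨾-cong (id⊕id [] []) (⨾-cong (coe≈ _) (⨾-cong (≈trans (⊕ˡ (σ-unit [])) (id⊕id [] [])) (coe≈ _))))
                     (≈trans (idˡ _) (≈trans (idˡ _) (idˡ _)))

  δ⁻-singleton : ∀ (u v : M) → δ⁻ {𝒮} (u ∷ []) v [] ≈T idT ((u ++ v) ∷ [])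
  δ⁻-singleton u v = ≈trans (⊕ʳ tail≈id) (⊕-unitʳ _)
    where
    tail≈id = ≈trans (⨾-cong (coe≈ _) (⨾-cong (≈trans (⊕ˡ (σ-unit [])) (id⊕id [] [])) (⨾-cong (coe≈ _) (id⊕id [] []))))
                     (≈trans (idˡ _) (≈trans (idˡ _) (idˡ _)))

  ⌈⌉⊗⌈⌉ : ∀ {u v u' v'} (c : C u v) (c' : C u' v') → (⌈ c ⌉ ⊗T ⌈ c' ⌉) ≈T ⌈ c ⊗C c' ⌉
  ⌈⌉⊗⌈⌉ {u} {v} {u'} {v'} c c' =
    ≈trans (⨾-cong (⊕-unitʳ _) (⨾-cong (δ-singleton u v') (⨾-cong (≈trans (⊕ʳ (coe≈ _)) (⊕-unitʳ _)) (δ⁻-singleton v v'))))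
   (≈trans (⨾ʳ (≈trans (idˡ _) (idʳ _)))
   (≈trans (≈sym (⌈⨾⌉ _ _))
   (⌈⌉-cong (≈trans (≈sym (interchange (idC u) c c' (idC v'))) (⊗-cong (idˡ c) (idʳ c'))))))

  ⌈⌉-mono : ∀ {u v} {c d : C u v} → c ≤C d → LeT 𝕀 ⌈ c ⌉ ⌈ d ⌉
  ⌈⌉-mono (ax x) = ax x
  ⌈⌉-mono (≈⇒≤ e) = ≈⇒≤ (⌈⌉-cong e)
  ⌈⌉-mono (≤trans p q) = ≤trans (⌈⌉-mono p) (⌈⌉-mono q)
  ⌈⌉-mono (⨾-mono p q) = ≤trans (≈⇒≤ (⌈⨾⌉ _ _)) (≤trans (⨾-mono (⌈⌉-mono p) (⌈⌉-mono q)) (≈⇒≤ (≈sym (⌈⨾⌉ _ _))))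
  ⌈⌉-mono (⊗-mono p q) = ≤trans (≈⇒≤ (≈sym (⌈⌉⊗⌈⌉ _ _))) (≤trans (⊗-mono (⌈⌉-mono p) (⌈⌉-mono q)) (≈⇒≤ (⌈⌉⊗⌈⌉ _ _)))

  ≤T-refl : ∀ {P Q} {x : T P Q} → LeT 𝕀 x x
  ≤T-refl = ≈⇒≤ ≈refl

  infixr 2 _≫_
  _≫_ : ∀ {P Q} {x y z : T P Q} → LeT 𝕀 x y → LeT 𝕀 y z → LeT 𝕀 x z
  _≫_ = ≤trans

  ⊞-mono : ∀ {P Q} {a a' b b' : T P Q} → LeT 𝕀 a a' → LeT 𝕀 b b' → LeT 𝕀 (a ⊞ b) (a' ⊞ b')
  ⊞-mono p q = ⨾-mono ≤T-refl (⨾-mono (⊕-mono p q) ≤T-refl)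

  Σ⊞-mono : ∀ {X Y} (L : Pl) {f g : Fin (length L) → T X Y} → (∀ i → LeT 𝕀 (f i) (g i)) → LeT 𝕀 (Σ⊞ L f) (Σ⊞ L g)
  Σ⊞-mono [] h = ≤T-refl
  Σ⊞-mono (U ∷ L) h = ⊞-mono (h zero) (Σ⊞-mono L (λ i → h (suc i)))

  ⊞-lub : ∀ {U V} {a b x : T (U ∷ []) (V ∷ [])} → LeT 𝕀 a x → LeT 𝕀 b x → LeT 𝕀 (a ⊞ b) x
  ⊞-lub {U} {V} {x = x} p q = ⊞-mono p q ≫ ≈⇒≤ x⊞x≈x⨾Δ∇ ≫ ⨾-mono ≤T-refl (Δ∇ V) ≫ ≈⇒≤ (idʳ x)
    where
    x⊞x≈x⨾Δ∇ : (x ⊞ x) ≈T (x ⨾ (Δ (V ∷ []) ⨾ ∇ (V ∷ [])))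
    x⊞x≈x⨾Δ∇ = ≈trans assocˡ (≈trans (⨾ˡ (≈sym (Δ-nat x))) (⨾-assoc _ _ _))

  𝟘-least : ∀ {U V} (x : T (U ∷ []) (V ∷ [])) → LeT 𝕀 𝟘 x
  𝟘-least {U} {V} x = ≈⇒≤ (≈trans (⨾ˡ (≈sym (!-nat x))) (⨾-assoc _ _ _)) ≫ ⨾-mono ≤T-refl (!¡ V) ≫ ≈⇒≤ (idʳ x)

  ⊞-upperˡ : ∀ {U V} (a b : T (U ∷ []) (V ∷ [])) → LeT 𝕀 a (a ⊞ b)
  ⊞-upperˡ a b = ≈⇒≤ (≈sym (⊞-unitʳ a)) ≫ ⊞-mono ≤T-refl (𝟘-least b)

  ⊞-upperʳ : ∀ {U V} (a b : T (U ∷ []) (V ∷ [])) → LeT 𝕀 b (a ⊞ b)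
  ⊞-upperʳ a b = ⊞-upperˡ b a ≫ ≈⇒≤ (⊞-comm b a)

  ∑-lub : ∀ {U V} (cs : List (C U V)) {x : T (U ∷ []) (V ∷ [])} → All (λ c → LeT 𝕀 ⌈ c ⌉ x) cs → LeT 𝕀 (∑ cs) x
  ∑-lub [] {x} [] = 𝟘-least x
  ∑-lub (c ∷ cs) (p ∷ ps) = ⊞-lub p (∑-lub cs ps)

  ∑-upper : ∀ {U V} {c : C U V} (ds : List (C U V)) → Any (c ≤C_) ds → LeT 𝕀 ⌈ c ⌉ (∑ ds)
  ∑-upper (d ∷ ds) (here p) = ⌈⌉-mono p ≫ ⊞-upperˡ _ _
  ∑-upper (d ∷ ds) (there m) = ∑-upper ds m ≫ ⊞-upperʳ _ _

  ∑-mono : ∀ {U V} (cs ds : List (C U V)) → All (λ c → Any (c ≤C_) ds) cs → LeT 𝕀 (∑ cs) (∑ ds)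
  ∑-mono cs ds h = ∑-lub cs (All.map (∑-upper ds) h)

  LeEM⇒LeT : ∀ {P Q} (t s : T P Q) →
    ((i : Fin (length P)) (j : Fin (length Q)) → LeEM 𝕀 (μ P i ⨾ t ⨾ π Q j) (μ P i ⨾ s ⨾ π Q j)) → LeT 𝕀 t s
  LeEM⇒LeT {P} {Q} t s h =
    ≈⇒≤ (matrix-decomposition t)
    ≫ Σ⊞-mono P (λ i → Σ⊞-mono Q (λ j → ⨾-mono ≤T-refl (⨾-mono (entry≤ i j) ≤T-refl)))
    ≫ ≈⇒≤ (≈sym (matrix-decomposition s))
    where
    entry≤ : ∀ i j → LeT 𝕀 (μ P i ⨾ t ⨾ π Q j) (μ P i ⨾ s ⨾ π Q j)
    entry≤ i j with h i j
    ... | cs , ds , t≈ , s≈ , cs≤ds = ≈⇒≤ t≈ ≫ ∑-mono cs ds cs≤ds ≫ ≈⇒≤ (≈sym s≈)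

  D-∑⁺ : ∀ {U V} {c : C U V} (cs : List (C U V)) → Any (c ≤C_) cs → D (∑ cs) 0 0 c
  D-∑⁺ (d ∷ cs) (here le) =
    seq (wire at0 (inj₁ refl) ≤refl) (seq (left (below le)) (wire at0 (inj₁ (s≤s z≤n , refl)) ≤refl) (≤-padʳ ≤refl)) (≤-padˡ ≤refl)
  D-∑⁺ (d ∷ cs) (there m) =
    seq (wire at0 (inj₂ refl) ≤refl) (seq (right refl refl (D-∑⁺ cs m)) (wire (atS at0) (inj₂ refl) ≤refl) (≤-padʳ ≤refl)) (≤-padˡ ≤refl)

  D-∑⁻ : ∀ {U V} {c : C U V} (ds : List (C U V)) → D (∑ ds) 0 0 c → Any (c ≤C_) ds
  D-∑⁻ [] (seq () _ _)
  D-∑⁻ (d ∷ ds) (seq (wire at0 (inj₁ refl) l1) (seq (left (below le)) (wire a3 r3 l3) l2) l0) =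
    here (≤⨾-dropˡ l0 l1 ⟫ ≤⨾-dropʳ l2 l3 ⟫ le)
  D-∑⁻ (d ∷ ds) (seq (wire at0 (inj₁ refl) l1) (seq (right () f x) (wire a3 r3 l3) l2) l0)
  D-∑⁻ (d ∷ ds) (seq (wire at0 (inj₂ refl) l1) (seq (right refl refl x) (wire a3 (inj₁ (s≤s () , _)) l3) l2) l0)
  D-∑⁻ (d ∷ ds) (seq (wire at0 (inj₂ refl) l1) (seq (right refl refl x) (wire a3 (inj₂ refl) l3) l2) l0) =
    there (D-∑⁻ ds (D-down (∑ ds) (≤⨾-dropˡ l0 l1 ⟫ ≤⨾-dropʳ l2 l3) x))

  LeT⇒LeEM : ∀ {P Q} (t s : T P Q) → LeT 𝕀 t s →
    (i : Fin (length P)) (j : Fin (length Q)) → LeEM 𝕀 (μ P i ⨾ t ⨾ π Q j) (μ P i ⨾ s ⨾ π Q j)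
  LeT⇒LeEM {P} {Q} t s t≤s i j with μ⨾t⨾π-SumForm t i j | μ⨾t⨾π-SumForm s i j
  ... | cs , t≈ | ds , s≈ = cs , ds , t≈ , s≈ , All.tabulate (λ c∈cs → D-∑⁻ ds (D∑cs⊆D∑ds (D-∑⁺ cs (Any.map (λ { refl → ≤refl }) c∈cs))))
    where
    D∑cs⊆D∑ds : D (∑ cs) ⊆ D (∑ ds)
    D∑cs⊆D∑ds x = proj₁ (D-cong s≈) (D-mono (⨾-mono (≤T-refl {x = μ P i}) (⨾-mono t≤s (≤T-refl {x = π Q j}))) (proj₂ (D-cong t≈) x))

open Characterisation using (LeT⇒LeEM; LeEM⇒LeT)

corollary6p10 : (𝒮 : Signature) (𝕀 : Theory 𝒮) {P Q : Poly 𝒮} (t s : Tape 𝒮 P Q) →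
    LeT 𝕀 t s ⇔
    ((i : Fin (length P)) (j : Fin (length Q)) →
    LeEM 𝕀 (μ P i ⨾ t ⨾ π Q j) (μ P i ⨾ s ⨾ π Q j))
corollary6p10 𝒮 𝕀 t s = mk⇔ (LeT⇒LeEM 𝕀 t s) (LeEM⇒LeT 𝕀 t s)
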